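{- Let $G$ be a finite simple undirected graph. Then the adjacency spectrum of the symmetric lift $\mathrm{HL}'_2(G)$ is the multiset union of the adjacency spectrum of the line graph $L(G)$ and the spectrum of the antisymmetric (signed) quotient $L^-(G)$: \[\operatorname{Spec}(\mathrm{HL}'_2(G))=\operatorname{Spec}(L(G))\cup\operatorname{Spec}(L^-(G)),\] with multiplicities preserved.
   Context: Symmetric lift: $B_{\mathrm{HL}'}(G)$ is the bipartite graph on $V'\sqcup V''$ (two disjoint copies of $V=V(G)$) with edges $u'v''$ and $v'u''$ for each edge $\{u,v\}$ of $G$, and $\mathrm{HL}'_2(G)=L(B_{\mathrm{HL}'}(G))$ is its line graph; its vertices are ordered pairs $(u,v)$ with $\{u,v\}\in E(G)$, distinct $(u,v),(x,y)$ adjacent iff $u=x$ or $v=y$. Antisymmetric line graph $L^-(G)$: fix a total order on $V$ and index rows and columns by the oriented edges $(u,v)$ with $u<v$, $\{u,v\}\in E(G)$. Define the symmetric matrix $M$ by $M_{(u,v),(x,y)}=+1$ if ($u=x$ and $v\ne y$) or ($v=y$ and $u\ne x$); $M_{(u,v),(x,y)}=-1$ if ($u=y$ and $v\ne x$) or ($v=x$ and $u\ne y$); and $0$ otherwise. $L^-(G)$ is the signed graph with adjacency matrix $M$ (equivalently, the restriction of the adjacency operator of $\mathrm{HL}'_2(G)$ to functions $f$ with $f(u,v)=-f(v,u)$), and $\operatorname{Spec}(L^-(G))$ is the multiset of eigenvalues of $M$. -}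

module Defs where

open import Data.Bool using (Bool; true; false; T; _∧_; _∨_; not; if_then_else_)
open import Data.Nat using (ℕ; zero; suc; _<ᵇ_)
open import Data.Fin using (Fin; zero; suc; toℕ; punchIn; _≟_)
open import Data.List using (List; length; lookup; map; concatMap; allFin; filterᵇ)
open import Data.Product using (_×_; _,_; proj₁; proj₂)
open import Data.Integer using (ℤ; +_; -[1+_]; _+_; _-_; _*_; -_)
open import Relation.Nullary.Decidable using (⌊_⌋)
open import Relation.Binary.PropositionalEquality using (_≡_)

record SimpleGraph : Set where
  field
    n       : ℕ
    adj     : Fin n → Fin n → Bool
    symm    : ∀ u v → adj u v ≡ adj v u
    irrefl  : ∀ u → adj u u ≡ false
open SimpleGraph public

Matrix : ℕ → Set
Matrix k = Fin k → Fin k → ℤ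

altSum : ∀ {k} → (Fin k → ℤ) → ℤ
altSum {zero}  f = + 0
altSum {suc k} f = f zero - altSum (λ j → f (suc j))

det : ∀ {k} → Matrix k → ℤ
det {zero}  A = + 1
det {suc k} A = altSum (λ j → A zero j * det (λ r c → A (suc r) (punchIn j c)))

_==_ : ∀ {k} → Fin k → Fin k → Bool
i == j = ⌊ i ≟ j ⌋

charPolyAt : ∀ {k} → Matrix k → ℤ → ℤ
charPolyAt A t = det (λ i j → (if i == j then t else + 0) - A i j)

listMatrix : ∀ {X : Set} (L : List X) → (X → X → ℤ) → Matrix (length L)
listMatrix L f i j = f (lookup L i) (lookup L j)

indicator : Bool → ℤ
indicator true  = + 1
indicator false = + 0

module _ (G : SimpleGraph) where
  private
    V = Fin (n G)
    pairs : List (V × V)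
    pairs = concatMap (λ u → map (λ v → (u , v)) (allFin (n G))) (allFin (n G))

  -- vertices of HL'_2(G) = edges of B_HL'(G): ordered pairs (u,v), {u,v} ∈ E(G)
  darts : List (V × V)
  darts = filterᵇ (λ p → adj G (proj₁ p) (proj₂ p)) pairs

  edges : List (V × V)
  edges = filterᵇ (λ p → adj G (proj₁ p) (proj₂ p) ∧ (toℕ (proj₁ p) <ᵇ toℕ (proj₂ p))) pairs

  -- adjacency matrix of HL'_2(G) = L(B_HL'(G)):
  -- distinct (u,v),(x,y) adjacent iff u = x or v = y
  adjHL : Matrix (length darts)
  adjHL = listMatrix darts λ { (u , v) (x , y) →
    indicator (not ((u == x) ∧ (v == y)) ∧ ((u == x) ∨ (v == y))) }

  adjL : Matrix (length edges)
  adjL = listMatrix edges λ { (u , v) (x , y) →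
    indicator (not ((u == x) ∧ (v == y))
               ∧ ((u == x) ∨ (u == y) ∨ (v == x) ∨ (v == y))) }

  antiM : Matrix (length edges)
  antiM = listMatrix edges λ { (u , v) (x , y) →
    if ((u == x) ∧ not (v == y)) ∨ ((v == y) ∧ not (u == x)) then + 1
    else if ((u == y) ∧ not (v == x)) ∨ ((v == x) ∧ not (u == y)) then -[1+ 0 ]
    else + 0 }

{-# OPTIONS --safe #-}
module Submission where

-- List the darts of G as the oriented edges e = (u, v), u < v, followed by their reversals ē.
-- Reversing both darts preserves adjacency in HL'₂(G), so in this order tI − A(HL'₂(G)) is the
-- block matrix [[P, Q], [Q, P]] with P = tI − H(e, e′) and Q = − H(e, ē′), H being adjacency of
-- darts, and its determinant is det (P + Q) · det (P − Q). H(e, e′) and H(e, ē′) record whether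
-- two oriented edges share an endpoint in the same or in opposite positions, and at most one of
-- these happens, so H(e, e′) + H(e, ē′) is the adjacency of L(G) and H(e, e′) − H(e, ē′) is the
-- signed matrix M of L⁻(G). Hence P + Q = tI − A(L(G)) and P − Q = tI − M.
--
-- The determinant identities used (reindexing, multiplicativity, transposition, block formulas)
-- all follow from the fact that det, the Laplace expansion along row 0, is the unique function
-- of the columns that is alternating, multilinear and normalised by det 1ₘ = 1; uniqueness is
-- proved by expanding column 0 and clearing the pivot row with column operations.

open import Data.Bool using (Bool; true; false; if_then_else_; not; _∧_; _∨_)
open import Data.Bool.Properties using (T-≡; T-∧; ∧-comm; ∨-comm)
open import Data.Empty using (⊥; ⊥-elim)
open import Data.Fin using (Fin; zero; suc; punchIn; punchOut; inject₁; toℕ; _≟_; _↑ˡ_; _↑ʳ_; splitAt; join)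
open import Data.Fin.Induction using (<-weakInduction)
open import Data.Fin.Permutation.Components using (transpose)
import Data.Fin.Properties as Finₚ
open import Data.Integer using (ℤ; +_; _+_; _-_; _*_; -_; -1ℤ)
import Data.Integer.Properties as ℤₚ
open import Algebra.Properties.Semiring.Sum ℤₚ.+-*-semiring
  using (sum; sum-syntax; sum-cong-≗; sum-replicate-zero; sum-remove; ∑-distrib-+; *-distribˡ-sum; *-distribʳ-sum)
import Algebra.Properties.AbelianGroup ℤₚ.+-0-abelianGroup as ℤ-group
open import Data.Integer.Tactic.RingSolver using (solve-∀)
open import Data.List
  using (List; []; _∷_; _++_; allFin; length; lookup; map; concatMap; cartesianProduct; filterᵇ)
open import Data.List.Membership.Propositional using (_∈_; _∉_)
open import Data.List.Membership.Propositional.Properties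
  using (∈-allFin; ∈-lookup; ∈-cartesianProduct⁺; ∈-filter⁺; ∈-filter⁻)
import Data.List.Relation.Unary.All as All
open import Data.List.Relation.Unary.Any as Any using (here; there)
import Data.List.Relation.Unary.Any.Properties as Anyₚ
open import Data.List.Relation.Unary.Unique.Propositional using (Unique; []; _∷_)
import Data.List.Relation.Unary.Unique.Propositional.Properties as Uniqueₚ
open import Data.Nat as ℕ using (ℕ; zero; suc; _<ᵇ_)
import Data.Nat.Properties as ℕₚ
open import Data.Product using (Σ; _×_; _,_; proj₁; proj₂; swap)
open import Data.Sum using (_⊎_; inj₁; inj₂; [_,_]′)
open import Data.Vec.Functional using (insertAt; removeAt)
open import Data.Vec.Functional.Properties using (insertAt-lookup; insertAt-punchIn)
open import Defs
open import Function using (_∘_; Equivalence)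
open import Relation.Binary.Definitions using (tri<; tri≈; tri>)
open import Relation.Binary.PropositionalEquality
open import Relation.Nullary using (yes; no)
open import Relation.Nullary.Decidable using (toSum; dec-true; dec-false; T?)

private
  variable
    k : ℕ

==-refl : (i : Fin k) → (i == i) ≡ true
==-refl i with i ≟ i
... | yes _  = refl
... | no i≢i = ⊥-elim (i≢i refl)

==-≢ : {i j : Fin k} → i ≢ j → (i == j) ≡ false
==-≢ {i = i} {j} i≢j with i ≟ j
... | yes i≡j = ⊥-elim (i≢j i≡j)
... | no _    = refl

==⇒≡ : {i j : Fin k} → (i == j) ≡ true → i ≡ j
==⇒≡ {i = i} {j} eq with i ≟ j
... | yes i≡j = i≡j

==-sym : (i j : Fin k) → (i == j) ≡ (j == i)
==-sym i j with i ≟ j | j ≟ i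
... | yes _   | yes _   = refl
... | yes i≡j | no j≢i  = ⊥-elim (j≢i (sym i≡j))
... | no i≢j  | yes j≡i = ⊥-elim (i≢j (sym j≡i))
... | no _    | no _    = refl

==-injective : ∀ {m n} (f : Fin m → Fin n) → (∀ {i j} → f i ≡ f j → i ≡ j) →
               ∀ i j → (f i == f j) ≡ (i == j)
==-injective f f-inj i j with f i ≟ f j | i ≟ j
... | yes _   | yes _   = refl
... | yes fij | no i≢j  = ⊥-elim (i≢j (f-inj fij))
... | no fi≢j | yes i≡j = ⊥-elim (fi≢j (cong f i≡j))
... | no _    | no _    = refl

punchIn-==-punchOut : {j c : Fin (suc k)} (j≢c : j ≢ c) (i : Fin k) →
                      (punchIn j i == c) ≡ (i == punchOut j≢c)
punchIn-==-punchOut {j = j} {c} j≢c i = begin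
  punchIn j i == c                          ≡⟨ cong (punchIn j i ==_) (sym (Finₚ.punchIn-punchOut j≢c)) ⟩
  punchIn j i == punchIn j (punchOut j≢c)   ≡⟨ ==-injective (punchIn j) (Finₚ.punchIn-injective j _ _) i _ ⟩
  i == punchOut j≢c                         ∎
  where open ≡-Reasoning

punchIn-inject₁-self : (i : Fin k) → punchIn (inject₁ i) i ≡ suc i
punchIn-inject₁-self zero    = refl
punchIn-inject₁-self (suc i) = cong suc (punchIn-inject₁-self i)

punchIn-suc-self : (i : Fin k) → punchIn (suc i) i ≡ inject₁ i
punchIn-suc-self zero    = refl
punchIn-suc-self (suc i) = cong suc (punchIn-suc-self i)

punchIn-suc≡punchIn-inject₁ : {i j : Fin k} → j ≢ i → punchIn (suc i) j ≡ punchIn (inject₁ i) j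
punchIn-suc≡punchIn-inject₁ {i = zero}  {zero}  j≢i = ⊥-elim (j≢i refl)
punchIn-suc≡punchIn-inject₁ {i = zero}  {suc j} _   = refl
punchIn-suc≡punchIn-inject₁ {i = suc i} {zero}  _   = refl
punchIn-suc≡punchIn-inject₁ {i = suc i} {suc j} j≢i = cong suc (punchIn-suc≡punchIn-inject₁ (j≢i ∘ cong suc))

punchIn-adjacent : (j : Fin (suc (suc k))) (c : Fin (suc k)) → j ≢ inject₁ c → j ≢ suc c →
  Σ (Fin k) λ c′ → punchIn j (inject₁ c′) ≡ inject₁ c × punchIn j (suc c′) ≡ suc c
punchIn-adjacent zero           zero    j≢c _   = ⊥-elim (j≢c refl)
punchIn-adjacent zero           (suc c) _   _   = c , refl , refl
punchIn-adjacent (suc zero)     zero    _   j≢c = ⊥-elim (j≢c refl)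
punchIn-adjacent {suc k} (suc (suc j)) zero _ _ = zero , refl , refl
punchIn-adjacent {suc k} (suc j) (suc c) j≢c j≢c′
  with punchIn-adjacent j c (j≢c ∘ cong suc) (j≢c′ ∘ cong suc)
... | c′ , eq , eq′ = suc c′ , cong suc eq , cong suc eq′

punchIn-↑ˡ : ∀ {a} b (j : Fin (suc a)) (c : Fin a) → punchIn (j ↑ˡ b) (c ↑ˡ b) ≡ punchIn j c ↑ˡ b
punchIn-↑ˡ b zero    c       = refl
punchIn-↑ˡ b (suc j) zero    = refl
punchIn-↑ˡ b (suc j) (suc c) = cong suc (punchIn-↑ˡ b j c)

punchIn-↑ʳ : ∀ {a} b (j : Fin (suc a)) (c : Fin b) → punchIn (j ↑ˡ b) (a ↑ʳ c) ≡ suc a ↑ʳ c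
punchIn-↑ʳ         b zero    c = refl
punchIn-↑ʳ {suc a} b (suc j) c = cong suc (punchIn-↑ʳ b j c)

transpose-matchˡ : (p q : Fin k) → transpose p q p ≡ q
transpose-matchˡ p q rewrite dec-true (p ≟ p) refl = refl

transpose-matchʳ : (p q : Fin k) → transpose p q q ≡ p
transpose-matchʳ p q with q ≟ p
... | yes q≡p = q≡p
... | no _ rewrite dec-true (q ≟ q) refl = refl

transpose-other : {p q j : Fin k} → j ≢ p → j ≢ q → transpose p q j ≡ j
transpose-other {p = p} {q} {j} j≢p j≢q
  rewrite dec-false (j ≟ p) j≢p | dec-false (j ≟ q) j≢q = refl

∑-zero : {f : Fin k → ℤ} → (∀ i → f i ≡ + 0) → ∑[ i < k ] f i ≡ + 0
∑-zero {k} f≗0 = trans (sum-cong-≗ f≗0) (sum-replicate-zero k)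

∑-↑ : ∀ a {b} (f : Fin (a ℕ.+ b) → ℤ) →
      ∑[ i < a ℕ.+ b ] f i ≡ ∑[ i < a ] f (i ↑ˡ b) + ∑[ i < b ] f (a ↑ʳ i)
∑-↑ zero    f = sym (ℤₚ.+-identityˡ (sum f))
∑-↑ (suc a) f = trans (cong (_+_ (f zero)) (∑-↑ a (f ∘ suc))) (sym (ℤₚ.+-assoc (f zero) _ _))

neg-∑ : (g : Fin k → ℤ) → - ∑[ i < k ] g i ≡ ∑[ i < k ] (- g i)
neg-∑ g = begin
  - sum g                ≡⟨ ℤₚ.-1*i≡-i (sum g) ⟨
  -1ℤ * sum g            ≡⟨ *-distribˡ-sum -1ℤ g ⟩
  sum (λ i → -1ℤ * g i)  ≡⟨ sum-cong-≗ (ℤₚ.-1*i≡-i ∘ g) ⟩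
  sum (λ i → - g i)      ∎
  where open ≡-Reasoning

sign : Fin k → ℤ
sign zero    = + 1
sign (suc i) = - sign i

sign-inject₁ : (i : Fin k) → sign (inject₁ i) ≡ sign i
sign-inject₁ zero    = refl
sign-inject₁ (suc i) = cong -_ (sign-inject₁ i)

altSum-cong : {f g : Fin k → ℤ} → (∀ j → f j ≡ g j) → altSum f ≡ altSum g
altSum-cong {zero}  f≗g = refl
altSum-cong {suc k} f≗g = cong₂ _-_ (f≗g zero) (altSum-cong (f≗g ∘ suc))

altSum-zero : {f : Fin k → ℤ} → (∀ j → f j ≡ + 0) → altSum f ≡ + 0
altSum-zero {zero}  f≗0 = refl
altSum-zero {suc k} f≗0 rewrite f≗0 zero | altSum-zero (f≗0 ∘ suc) = refl

altSum-+ : (f g : Fin k → ℤ) → altSum (λ j → f j + g j) ≡ altSum f + altSum g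
altSum-+ {zero}  f g = refl
altSum-+ {suc k} f g rewrite altSum-+ (f ∘ suc) (g ∘ suc) =
  interchange (f zero) (g zero) (altSum (f ∘ suc)) (altSum (g ∘ suc))
  where
  interchange : ∀ a b c d → a + b - (c + d) ≡ a - c + (b - d)
  interchange = solve-∀

altSum-*ˡ : (a : ℤ) (f : Fin k → ℤ) → altSum (λ j → a * f j) ≡ a * altSum f
altSum-*ˡ {zero}  a f = sym (ℤₚ.*-zeroʳ a)
altSum-*ˡ {suc k} a f rewrite altSum-*ˡ a (f ∘ suc) =
  distrib a (f zero) (altSum (f ∘ suc))
  where
  distrib : ∀ a b c → a * b - a * c ≡ a * (b - c)
  distrib = solve-∀

altSum-*ʳ : (a : ℤ) (f : Fin k → ℤ) → altSum (λ j → f j * a) ≡ altSum f * a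
altSum-*ʳ a f = begin
  altSum (λ j → f j * a)  ≡⟨ altSum-cong (λ j → ℤₚ.*-comm (f j) a) ⟩
  altSum (λ j → a * f j)  ≡⟨ altSum-*ˡ a f ⟩
  a * altSum f            ≡⟨ ℤₚ.*-comm a (altSum f) ⟩
  altSum f * a            ∎
  where open ≡-Reasoning

altSum-adjacent : (f : Fin (suc k) → ℤ) (c : Fin k) → f (inject₁ c) ≡ f (suc c) →
                  (∀ j → j ≢ inject₁ c → j ≢ suc c → f j ≡ + 0) → altSum f ≡ + 0
altSum-adjacent f zero f₀≡f₁ rest
  rewrite altSum-zero (λ j → rest (suc (suc j)) (λ ()) (λ ())) | f₀≡f₁ = cancel (f (suc zero))
  where
  cancel : ∀ a → a - (a - + 0) ≡ + 0
  cancel = solve-∀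
altSum-adjacent f (suc c) f₀≡f₁ rest
  rewrite rest zero (λ ()) (λ ())
        | altSum-adjacent (f ∘ suc) c f₀≡f₁
            (λ j j≢ j≢′ → rest (suc j) (j≢ ∘ Finₚ.suc-injective) (j≢′ ∘ Finₚ.suc-injective))
  = refl

altSum-↑ˡ : ∀ a {b} (f : Fin (a ℕ.+ b) → ℤ) → (∀ c → f (a ↑ʳ c) ≡ + 0) →
            altSum f ≡ altSum (λ j → f (j ↑ˡ b))
altSum-↑ˡ zero    f f≗0 = altSum-zero f≗0
altSum-↑ˡ (suc a) f f≗0 = cong (_-_ (f zero)) (altSum-↑ˡ a (f ∘ suc) f≗0)

altSum≡∑sign : (f : Fin k → ℤ) → altSum f ≡ ∑[ i < k ] (sign i * f i)
altSum≡∑sign {zero}  f = refl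
altSum≡∑sign {suc k} f = cong₂ _+_ (sym (ℤₚ.*-identityˡ (f zero))) (begin
  - altSum (f ∘ suc)                   ≡⟨ cong -_ (altSum≡∑sign (f ∘ suc)) ⟩
  - sum (λ i → sign i * f (suc i))     ≡⟨ neg-∑ (λ i → sign i * f (suc i)) ⟩
  sum (λ i → - (sign i * f (suc i)))   ≡⟨ sum-cong-≗ (λ i → ℤₚ.neg-distribˡ-* (sign i) (f (suc i))) ⟩
  sum (λ i → - sign i * f (suc i))     ∎)
  where open ≡-Reasoning

infix 4 _≗ₘ_

_≗ₘ_ : Matrix k → Matrix k → Set
A ≗ₘ B = ∀ i j → A i j ≡ B i j

1ₘ : Matrix k
1ₘ i j = indicator (i == j)

0ₘ : Matrix k
0ₘ _ _ = + 0

_·1ₘ : ℤ → Matrix k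
(t ·1ₘ) i j = if i == j then t else + 0

·1ₘ-injective : ∀ {a b} (t : ℤ) (f : Fin a → Fin b) → (∀ {i j} → f i ≡ f j → i ≡ j) →
                ∀ i j → (t ·1ₘ) (f i) (f j) ≡ (t ·1ₘ) i j
·1ₘ-injective t f f-inj i j = cong (λ b → if b then t else + 0) (==-injective f f-inj i j)

·1ₘ-sym : (t : ℤ) (i j : Fin k) → (t ·1ₘ) i j ≡ (t ·1ₘ) j i
·1ₘ-sym t i j = cong (λ b → if b then t else + 0) (==-sym i j)

·1ₘ-↑ˡ↑ʳ : ∀ {m} (t : ℤ) (i j : Fin m) → (t ·1ₘ) (i ↑ˡ m) (m ↑ʳ j) ≡ + 0
·1ₘ-↑ˡ↑ʳ {m} t i j = cong (λ b → if b then t else + 0) (==-≢ ↑ˡ≢↑ʳ)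
  where
  ↑ˡ≢↑ʳ : i ↑ˡ m ≢ m ↑ʳ j
  ↑ˡ≢↑ʳ eq
    with () ← trans (sym (Finₚ.splitAt-↑ˡ m i m)) (trans (cong (splitAt m) eq) (Finₚ.splitAt-↑ʳ m m j))

_ᵀ : Matrix k → Matrix k
(A ᵀ) i j = A j i

infixl 7 _*ᵥ_ _*ₘ_

_*ᵥ_ : Matrix k → (Fin k → ℤ) → Fin k → ℤ
(A *ᵥ v) r = ∑[ m < _ ] (A r m * v m)

_*ₘ_ : Matrix k → Matrix k → Matrix k
(A *ₘ B) r c = (A *ᵥ (λ m → B m c)) r

∑-1ₘʳ : (f : Fin k → ℤ) (r : Fin k) → ∑[ i < k ] (f i * 1ₘ i r) ≡ f r
∑-1ₘʳ {suc k} f r = begin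
  sum g                                   ≡⟨ sum-remove {i = r} g ⟩
  f r * indicator (r == r) + sum (removeAt g r)
    ≡⟨ cong₂ _+_ (cong (λ b → f r * indicator b) (==-refl r)) (∑-zero off-diagonal) ⟩
  f r * + 1 + + 0                         ≡⟨ cong (_+ + 0) (ℤₚ.*-identityʳ (f r)) ⟩
  f r + + 0                               ≡⟨ ℤₚ.+-identityʳ (f r) ⟩
  f r                                     ∎
  where
  open ≡-Reasoning
  g = λ i → f i * 1ₘ i r
  off-diagonal : ∀ j → g (punchIn r j) ≡ + 0
  off-diagonal j rewrite ==-≢ (Finₚ.punchInᵢ≢i r j) = ℤₚ.*-zeroʳ (f (punchIn r j))

∑-1ₘˡ : (f : Fin k → ℤ) (r : Fin k) → ∑[ i < k ] (1ₘ r i * f i) ≡ f r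
∑-1ₘˡ f r = trans (sum-cong-≗ λ i → trans (ℤₚ.*-comm (1ₘ r i) (f i)) (cong (λ b → f i * indicator b) (==-sym r i)))
                  (∑-1ₘʳ f r)

*ₘ-1ₘ : (A : Matrix k) → A *ₘ 1ₘ ≗ₘ A
*ₘ-1ₘ A r c = ∑-1ₘʳ (A r) c

setColumn : Matrix k → Fin k → (Fin k → ℤ) → Matrix k
setColumn B c v r j = if j == c then v r else B r j

setColumn-≡ : ∀ (B : Matrix k) c v r → setColumn B c v r c ≡ v r
setColumn-≡ B c v r rewrite ==-refl c = refl

setColumn-≢ : ∀ (B : Matrix k) c v r {j} → j ≢ c → setColumn B c v r j ≡ B r j
setColumn-≢ B c v r j≢c rewrite ==-≢ j≢c = refl

setColumn-cong : ∀ (B : Matrix k) c {v w : Fin k → ℤ} → (∀ r → v r ≡ w r) →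
                 setColumn B c v ≗ₘ setColumn B c w
setColumn-cong B c v≗w r j = cong (λ z → if j == c then z else B r j) (v≗w r)

setColumn-comm : ∀ (B : Matrix k) {p q} u w → p ≢ q →
                 setColumn (setColumn B p u) q w ≗ₘ setColumn (setColumn B q w) p u
setColumn-comm B {p} {q} u w p≢q r j with j ≟ p | j ≟ q
... | yes refl | yes refl = ⊥-elim (p≢q refl)
... | yes _    | no _     = refl
... | no _     | yes _    = refl
... | no _     | no _     = refl

setColumn-self : ∀ (B : Matrix k) c → setColumn B c (λ r → B r c) ≗ₘ B
setColumn-self B c r j with j ≟ c
... | yes refl = refl
... | no _     = refl

*ₘ-setColumn : ∀ (A B : Matrix k) c v → A *ₘ setColumn B c v ≗ₘ setColumn (A *ₘ B) c (A *ᵥ v)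
*ₘ-setColumn A B c v r j with toSum (j ≟ c)
... | inj₁ refl = trans (sum-cong-≗ (λ m → cong (A r m *_) (setColumn-≡ B j v m)))
                        (sym (setColumn-≡ (A *ₘ B) j (A *ᵥ v) r))
... | inj₂ j≢c  = trans (sum-cong-≗ (λ m → cong (A r m *_) (setColumn-≢ B c v m j≢c)))
                        (sym (setColumn-≢ (A *ₘ B) c (A *ᵥ v) r j≢c))

swapColumns : Fin k → Fin k → Matrix k → Matrix k
swapColumns p q B r j = B r (transpose p q j)

minor : Matrix (suc k) → Fin (suc k) → Matrix k
minor A j r c = A (suc r) (punchIn j c)

laplaceTerm : Matrix (suc k) → Fin (suc k) → ℤ
laplaceTerm A j = A zero j * det (minor A j)

minor-1ₘ : minor (1ₘ {suc k}) zero ≗ₘ 1ₘ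
minor-1ₘ r c = cong indicator (==-injective suc Finₚ.suc-injective r c)

block : ∀ {m} (X Y W Z : Matrix m) → Matrix (m ℕ.+ m)
block {m} X Y W Z r c =
  [ (λ i → [ X i , Y i ]′ (splitAt m c)) , (λ i → [ W i , Z i ]′ (splitAt m c)) ]′ (splitAt m r)

module _ {m} (X Y W Z : Matrix m) where

  block-↑ˡ↑ˡ : ∀ i j → block X Y W Z (i ↑ˡ m) (j ↑ˡ m) ≡ X i j
  block-↑ˡ↑ˡ i j rewrite Finₚ.splitAt-↑ˡ m i m | Finₚ.splitAt-↑ˡ m j m = refl

  block-↑ˡ↑ʳ : ∀ i j → block X Y W Z (i ↑ˡ m) (m ↑ʳ j) ≡ Y i j
  block-↑ˡ↑ʳ i j rewrite Finₚ.splitAt-↑ˡ m i m | Finₚ.splitAt-↑ʳ m m j = refl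

  block-↑ʳ↑ˡ : ∀ i j → block X Y W Z (m ↑ʳ i) (j ↑ˡ m) ≡ W i j
  block-↑ʳ↑ˡ i j rewrite Finₚ.splitAt-↑ʳ m m i | Finₚ.splitAt-↑ˡ m j m = refl

  block-↑ʳ↑ʳ : ∀ i j → block X Y W Z (m ↑ʳ i) (m ↑ʳ j) ≡ Z i j
  block-↑ʳ↑ʳ i j rewrite Finₚ.splitAt-↑ʳ m m i | Finₚ.splitAt-↑ʳ m m j = refl

det-cong : {A B : Matrix k} → A ≗ₘ B → det A ≡ det B
det-cong {zero}  A≗B = refl
det-cong {suc k} A≗B =
  altSum-cong (λ j → cong₂ _*_ (A≗B zero j) (det-cong (λ r c → A≗B (suc r) (punchIn j c))))

module _ (B : Matrix (suc k)) (c : Fin (suc k)) (v : Fin (suc k) → ℤ) where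

  minor-setColumn-≡ : minor (setColumn B c v) c ≗ₘ minor B c
  minor-setColumn-≡ r i = setColumn-≢ B c v (suc r) (Finₚ.punchInᵢ≢i c i)

  minor-setColumn-≢ : ∀ {j} (j≢c : j ≢ c) →
                      minor (setColumn B c v) j ≗ₘ setColumn (minor B j) (punchOut j≢c) (v ∘ suc)
  minor-setColumn-≢ {j} j≢c r i =
    cong (λ b → if b then v (suc r) else B (suc r) (punchIn j i)) (punchIn-==-punchOut j≢c i)

  laplaceTerm-setColumn-≡ : laplaceTerm (setColumn B c v) c ≡ v zero * det (minor B c)
  laplaceTerm-setColumn-≡ = cong₂ _*_ (setColumn-≡ B c v zero) (det-cong minor-setColumn-≡)

  laplaceTerm-setColumn-≢ : ∀ {j} (j≢c : j ≢ c) → laplaceTerm (setColumn B c v) j ≡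
                            B zero j * det (setColumn (minor B j) (punchOut j≢c) (v ∘ suc))
  laplaceTerm-setColumn-≢ j≢c = cong₂ _*_ (setColumn-≢ B c v zero j≢c) (det-cong (minor-setColumn-≢ j≢c))

det-setColumn-+ : (B : Matrix k) (c : Fin k) (x y : Fin k → ℤ) →
  det (setColumn B c (λ r → x r + y r)) ≡ det (setColumn B c x) + det (setColumn B c y)
det-setColumn-+ {suc k} B c x y =
  trans (altSum-cong term) (altSum-+ (laplaceTerm (setColumn B c x)) (laplaceTerm (setColumn B c y)))
  where
  open ≡-Reasoning
  x+y = λ r → x r + y r
  term : ∀ j → laplaceTerm (setColumn B c x+y) j ≡
               laplaceTerm (setColumn B c x) j + laplaceTerm (setColumn B c y) j
  term j with toSum (j ≟ c)
  ... | inj₁ refl = begin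
    _                                          ≡⟨ laplaceTerm-setColumn-≡ B j x+y ⟩
    (x zero + y zero) * det (minor B j)        ≡⟨ ℤₚ.*-distribʳ-+ _ (x zero) (y zero) ⟩
    x zero * det (minor B j) + y zero * det (minor B j)
      ≡⟨ sym (cong₂ _+_ (laplaceTerm-setColumn-≡ B j x) (laplaceTerm-setColumn-≡ B j y)) ⟩
    _                                          ∎
  ... | inj₂ j≢c = begin
    _ ≡⟨ laplaceTerm-setColumn-≢ B c x+y j≢c ⟩
    B zero j * det (setColumn (minor B j) c′ (x+y ∘ suc))
      ≡⟨ cong (B zero j *_) (det-setColumn-+ (minor B j) c′ (x ∘ suc) (y ∘ suc)) ⟩
    B zero j * (det (setColumn (minor B j) c′ (x ∘ suc)) + det (setColumn (minor B j) c′ (y ∘ suc)))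
      ≡⟨ ℤₚ.*-distribˡ-+ (B zero j) _ _ ⟩
    B zero j * det (setColumn (minor B j) c′ (x ∘ suc)) + B zero j * det (setColumn (minor B j) c′ (y ∘ suc))
      ≡⟨ sym (cong₂ _+_ (laplaceTerm-setColumn-≢ B c x j≢c) (laplaceTerm-setColumn-≢ B c y j≢c)) ⟩
    _ ∎
    where c′ = punchOut j≢c

det-setColumn-* : (B : Matrix k) (c : Fin k) (a : ℤ) (x : Fin k → ℤ) →
  det (setColumn B c (λ r → a * x r)) ≡ a * det (setColumn B c x)
det-setColumn-* {suc k} B c a x = trans (altSum-cong term) (altSum-*ˡ a (laplaceTerm (setColumn B c x)))
  where
  open ≡-Reasoning
  ax = λ r → a * x r
  swap-* : ∀ b a d → b * (a * d) ≡ a * (b * d)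
  swap-* = solve-∀
  term : ∀ j → laplaceTerm (setColumn B c ax) j ≡ a * laplaceTerm (setColumn B c x) j
  term j with toSum (j ≟ c)
  ... | inj₁ refl = begin
    _                               ≡⟨ laplaceTerm-setColumn-≡ B j ax ⟩
    a * x zero * det (minor B j)    ≡⟨ ℤₚ.*-assoc a (x zero) _ ⟩
    a * (x zero * det (minor B j))  ≡⟨ sym (cong (a *_) (laplaceTerm-setColumn-≡ B j x)) ⟩
    _                               ∎
  ... | inj₂ j≢c = begin
    _ ≡⟨ laplaceTerm-setColumn-≢ B c ax j≢c ⟩
    B zero j * det (setColumn (minor B j) c′ (ax ∘ suc))
      ≡⟨ cong (B zero j *_) (det-setColumn-* (minor B j) c′ a (x ∘ suc)) ⟩
    B zero j * (a * det (setColumn (minor B j) c′ (x ∘ suc)))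
      ≡⟨ swap-* (B zero j) a _ ⟩
    a * (B zero j * det (setColumn (minor B j) c′ (x ∘ suc)))
      ≡⟨ sym (cong (a *_) (laplaceTerm-setColumn-≢ B c x j≢c)) ⟩
    _ ∎
    where c′ = punchOut j≢c

det-adjacentColumns : (A : Matrix (suc k)) (c : Fin k) →
  (∀ r → A r (inject₁ c) ≡ A r (suc c)) → det A ≡ + 0
det-adjacentColumns {suc k} A c cols≡ = altSum-adjacent (laplaceTerm A) c
  (cong₂ _*_ (cols≡ zero) (det-cong minors≡)) otherTerms
  where
  minors≡ : minor A (inject₁ c) ≗ₘ minor A (suc c)
  minors≡ r i with toSum (i ≟ c)
  ... | inj₁ refl rewrite punchIn-inject₁-self i | punchIn-suc-self i = sym (cols≡ (suc r))
  ... | inj₂ i≢c  = cong (A (suc r)) (sym (punchIn-suc≡punchIn-inject₁ i≢c))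
  otherTerms : ∀ j → j ≢ inject₁ c → j ≢ suc c → laplaceTerm A j ≡ + 0
  otherTerms j j≢c j≢c′ with punchIn-adjacent j c j≢c j≢c′
  ... | c′ , eq , eq′ = trans
    (cong (A zero j *_) (det-adjacentColumns (minor A j) c′
      (λ r → trans (cong (A (suc r)) eq) (trans (cols≡ (suc r)) (cong (A (suc r)) (sym eq′))))))
    (ℤₚ.*-zeroʳ (A zero j))

record IsMultilinear (G : Matrix k → ℤ) : Set where
  field
    resp-≗ₘ     : ∀ {A B} → A ≗ₘ B → G A ≡ G B
    additive    : ∀ B c (x y : Fin k → ℤ) →
                  G (setColumn B c (λ r → x r + y r)) ≡ G (setColumn B c x) + G (setColumn B c y)
    homogeneous : ∀ B c a (x : Fin k → ℤ) →
                  G (setColumn B c (λ r → a * x r)) ≡ a * G (setColumn B c x)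

  zeroColumn : ∀ B c → G (setColumn B c (λ _ → + 0)) ≡ + 0
  zeroColumn B c = begin
    G (setColumn B c (λ _ → + 0))           ≡⟨ homogeneous B c (+ 0) (λ _ → + 0) ⟩
    + 0 * G (setColumn B c (λ _ → + 0))     ≡⟨ ℤₚ.*-zeroˡ (G (setColumn B c (λ _ → + 0)))⟩
    + 0                                     ∎
    where open ≡-Reasoning

  ∑-column : ∀ {m} B c (f : Fin m → Fin k → ℤ) →
             G (setColumn B c (λ r → ∑[ i < m ] f i r)) ≡ ∑[ i < m ] G (setColumn B c (f i))
  ∑-column {zero}  B c f = zeroColumn B c
  ∑-column {suc m} B c f = trans (additive B c (f zero) (λ r → ∑[ i < m ] f (suc i) r))
                                 (cong (_+_ (G (setColumn B c (f zero)))) (∑-column B c (f ∘ suc)))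

record IsAlternating (G : Matrix k → ℤ) : Set where
  field
    isMultilinear : IsMultilinear G
    equalColumns  : ∀ B {p q} → p ≢ q → (∀ r → B r p ≡ B r q) → G B ≡ + 0
  open IsMultilinear isMultilinear public

  addColumnMultiple : ∀ B {c d} a → c ≢ d → G (setColumn B c (λ r → B r c + a * B r d)) ≡ G B
  addColumnMultiple B {c} {d} a c≢d = begin
    G (setColumn B c (λ r → B r c + a * B r d))
      ≡⟨ additive B c (λ r → B r c) (λ r → a * B r d) ⟩
    G (setColumn B c (λ r → B r c)) + G (setColumn B c (λ r → a * B r d))
      ≡⟨ cong₂ _+_ (resp-≗ₘ (setColumn-self B c)) (homogeneous B c a (λ r → B r d)) ⟩
    G B + a * G (setColumn B c (λ r → B r d))
      ≡⟨ cong (λ g → G B + a * g) (equalColumns (setColumn B c (λ r → B r d)) c≢d columns≡) ⟩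
    G B + a * + 0
      ≡⟨ cong (_+_ (G B)) (ℤₚ.*-zeroʳ a) ⟩
    G B + + 0
      ≡⟨ ℤₚ.+-identityʳ (G B) ⟩
    G B ∎
    where
    open ≡-Reasoning
    columns≡ : ∀ r → setColumn B c (λ r → B r d) r c ≡ setColumn B c (λ r → B r d) r d
    columns≡ r = trans (setColumn-≡ B c (λ r → B r d) r) (sym (setColumn-≢ B c (λ r → B r d) r (c≢d ∘ sym)))

det-isMultilinear : IsMultilinear (det {k})
det-isMultilinear = record
  { resp-≗ₘ = det-cong ; additive = det-setColumn-+ ; homogeneous = det-setColumn-* }

module _ {G : Matrix k → ℤ} (G-multilinear : IsMultilinear G) {p q : Fin k} (p≢q : p ≢ q)
         (G-p≡q : ∀ B → (∀ r → B r p ≡ B r q) → G B ≡ + 0) where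
  open IsMultilinear G-multilinear

  -- Expand 0 = G (.., x + y, .., x + y, ..) by additivity in columns p and q.
  swapColumns-anti : ∀ B → G (swapColumns p q B) ≡ - G B
  swapColumns-anti B = ℤ-group.inverseʳ-unique (G B) (G (swapColumns p q B)) (sym (begin
    + 0                                 ≡⟨ sym (G-p≡q (M s s) M-diagonal) ⟩
    G (M s s)                           ≡⟨ additiveˡ x y s ⟩
    G (M x s) + G (M y s)               ≡⟨ cong₂ _+_ (additive _ q x y) (additive _ q x y) ⟩
    (G (M x x) + G (M x y)) + (G (M y x) + G (M y y))
      ≡⟨ cong₂ _+_ (cong₂ _+_ (G-p≡q (M x x) M-diagonal) (resp-≗ₘ Mxy≗B))
                   (cong₂ _+_ (resp-≗ₘ Myx≗swap) (G-p≡q (M y y) M-diagonal)) ⟩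
    (+ 0 + G B) + (G (swapColumns p q B) + + 0)
      ≡⟨ cong₂ _+_ (ℤₚ.+-identityˡ (G B)) (ℤₚ.+-identityʳ (G (swapColumns p q B))) ⟩
    G B + G (swapColumns p q B)         ∎))
    where
    open ≡-Reasoning
    x y s : Fin k → ℤ
    x r = B r p
    y r = B r q
    s r = x r + y r
    M : (Fin k → ℤ) → (Fin k → ℤ) → Matrix k
    M u w = setColumn (setColumn B p u) q w
    additiveˡ : ∀ u v w → G (M (λ r → u r + v r) w) ≡ G (M u w) + G (M v w)
    additiveˡ u v w = begin
      G (M (λ r → u r + v r) w)  ≡⟨ resp-≗ₘ (setColumn-comm B _ w p≢q) ⟩
      G (setColumn (setColumn B q w) p (λ r → u r + v r))  ≡⟨ additive _ p u v ⟩
      G (setColumn (setColumn B q w) p u) + G (setColumn (setColumn B q w) p v)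
        ≡⟨ sym (cong₂ _+_ (resp-≗ₘ (setColumn-comm B u w p≢q)) (resp-≗ₘ (setColumn-comm B v w p≢q))) ⟩
      G (M u w) + G (M v w)      ∎
    M-diagonal : ∀ {u} r → M u u r p ≡ M u u r q
    M-diagonal r rewrite ==-≢ p≢q | ==-refl p | ==-refl q = refl
    Mxy≗B : M x y ≗ₘ B
    Mxy≗B r j with j ≟ q | j ≟ p
    ... | yes refl | _        = refl
    ... | no _     | yes refl = refl
    ... | no _     | no _     = refl
    Myx≗swap : M y x ≗ₘ swapColumns p q B
    Myx≗swap r j with toSum (j ≟ q) | toSum (j ≟ p)
    ... | inj₁ refl | _         = trans (setColumn-≡ (setColumn B p y) j x r) (sym (cong (B r) (transpose-matchʳ p j)))
    ... | inj₂ j≢q  | inj₁ refl = trans (setColumn-≢ (setColumn B p y) q x r j≢q)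
                                    (trans (setColumn-≡ B j y r) (sym (cong (B r) (transpose-matchˡ j q))))
    ... | inj₂ j≢q  | inj₂ j≢p  = trans (setColumn-≢ (setColumn B p y) q x r j≢q)
                                    (trans (setColumn-≢ B p y r j≢p) (sym (cong (B r) (transpose-other j≢p j≢q))))
module _ {G : Matrix (suc k) → ℤ} (G-multilinear : IsMultilinear G)
         (G-adjacent : ∀ B c → (∀ r → B r (inject₁ c) ≡ B r (suc c)) → G B ≡ + 0) where

  private
    inject₁≢suc : (c : Fin k) → inject₁ c ≢ suc c
    inject₁≢suc c eq = ℕₚ.<⇒≢ (ℕₚ.n<1+n (toℕ c)) (trans (sym (Finₚ.toℕ-inject₁ c)) (cong toℕ eq))

    VanishesOnCopyLeftOf : Fin (suc k) → Set
    VanishesOnCopyLeftOf q = ∀ B p → toℕ p ℕ.< toℕ q → (∀ r → B r p ≡ B r q) → G B ≡ + 0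

    -- Unless p = q, swapping columns q and q + 1 moves the copy in column q + 1 to column q.
    moveLeft : ∀ q → VanishesOnCopyLeftOf (inject₁ q) → VanishesOnCopyLeftOf (suc q)
    moveLeft q ih B p p<q cols≡ with ℕₚ.m≤n⇒m<n∨m≡n (ℕₚ.≤-pred p<q)
    ... | inj₂ p≡q = G-adjacent B q (λ r → trans (cong (B r) (sym p≡q′)) (cols≡ r))
      where p≡q′ = Finₚ.toℕ-injective (trans p≡q (sym (Finₚ.toℕ-inject₁ q)))
    ... | inj₁ p<q′ = begin
      G B      ≡⟨ ℤₚ.neg-involutive (G B) ⟨
      - - G B  ≡⟨ cong -_ (swapColumns-anti G-multilinear (inject₁≢suc q) (λ B′ → G-adjacent B′ q) B) ⟨
      - G B′   ≡⟨ cong -_ (ih B′ p (subst (toℕ p ℕ.<_) (sym (Finₚ.toℕ-inject₁ q)) p<q′) cols′≡) ⟩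
      + 0      ∎
      where
      open ≡-Reasoning
      B′ = swapColumns (inject₁ q) (suc q) B
      p≢q : p ≢ inject₁ q
      p≢q eq = ℕₚ.<⇒≢ p<q′ (trans (cong toℕ eq) (Finₚ.toℕ-inject₁ q))
      p≢sq : p ≢ suc q
      p≢sq eq = ℕₚ.<⇒≢ p<q (cong toℕ eq)
      cols′≡ : ∀ r → B′ r p ≡ B′ r (inject₁ q)
      cols′≡ r = trans (cong (B r) (transpose-other p≢q p≢sq))
                   (trans (cols≡ r) (cong (B r) (sym (transpose-matchˡ (inject₁ q) (suc q)))))

    vanishesOnCopyLeftOf : ∀ q → VanishesOnCopyLeftOf q
    vanishesOnCopyLeftOf = <-weakInduction VanishesOnCopyLeftOf (λ _ _ ()) moveLeft

  adjacent⇒alternating : IsAlternating G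
  adjacent⇒alternating = record { isMultilinear = G-multilinear ; equalColumns = equalColumns }
    where
    equalColumns : ∀ B {p q} → p ≢ q → (∀ r → B r p ≡ B r q) → G B ≡ + 0
    equalColumns B {p} {q} p≢q cols≡ with Finₚ.<-cmp p q
    ... | tri< p<q _ _ = vanishesOnCopyLeftOf q B p p<q cols≡
    ... | tri≈ _ p≡q _ = ⊥-elim (p≢q p≡q)
    ... | tri> _ _ q<p = vanishesOnCopyLeftOf p B q q<p (sym ∘ cols≡)

det-isAlternating : IsAlternating (det {k})
det-isAlternating {zero}  =
  record { isMultilinear = det-isMultilinear ; equalColumns = λ _ {p} → ⊥-elim (Finₚ.¬Fin0 p) }
det-isAlternating {suc k} = adjacent⇒alternating det-isMultilinear det-adjacentColumns

module _ {A : Set} where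

  insertAt-cong : {x y : Fin k → A} → (∀ r → x r ≡ y r) → ∀ i v r → insertAt x i v r ≡ insertAt y i v r
  insertAt-cong         x≗y zero    v zero    = refl
  insertAt-cong         x≗y zero    v (suc r) = x≗y r
  insertAt-cong {suc k} x≗y (suc i) v zero    = x≗y zero
  insertAt-cong {suc k} x≗y (suc i) v (suc r) = insertAt-cong (x≗y ∘ suc) i v r

  insertAt-punchOut : (x : Fin k → A) (i : Fin (suc k)) (v : A) {r : Fin (suc k)} (i≢r : i ≢ r) →
                      insertAt x i v r ≡ x (punchOut i≢r)
  insertAt-punchOut x i v i≢r = begin
    insertAt x i v _                          ≡⟨ cong (insertAt x i v) (Finₚ.punchIn-punchOut i≢r) ⟨
    insertAt x i v (punchIn i (punchOut i≢r)) ≡⟨ insertAt-punchIn x i v (punchOut i≢r) ⟩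
    x (punchOut i≢r)                          ∎
    where open ≡-Reasoning

  module _ {B C : Set} (f : A → B → C) where

    insertAt-zipWith : ∀ (x : Fin k → A) (y : Fin k → B) i a b r →
                       insertAt (λ r → f (x r) (y r)) i (f a b) r ≡ f (insertAt x i a r) (insertAt y i b r)
    insertAt-zipWith         x y zero    a b zero    = refl
    insertAt-zipWith         x y zero    a b (suc r) = refl
    insertAt-zipWith {suc k} x y (suc i) a b zero    = refl
    insertAt-zipWith {suc k} x y (suc i) a b (suc r) = insertAt-zipWith (x ∘ suc) (y ∘ suc) i a b r

  module _ {B : Set} (f : A → B) where

    insertAt-map : ∀ (x : Fin k → A) i a r → insertAt (f ∘ x) i (f a) r ≡ f (insertAt x i a r)
    insertAt-map         x zero    a zero    = refl
    insertAt-map         x zero    a (suc r) = refl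
    insertAt-map {suc k} x (suc i) a zero    = refl
    insertAt-map {suc k} x (suc i) a (suc r) = insertAt-map (x ∘ suc) i a r

border : Fin (suc k) → Matrix k → Matrix (suc k)
border i N r zero    = 1ₘ i r
border i N r (suc c) = insertAt (λ r′ → N r′ c) i (+ 0) r

border-cong : ∀ i {M N : Matrix k} → M ≗ₘ N → border i M ≗ₘ border i N
border-cong i M≗N r zero    = refl
border-cong i M≗N r (suc c) = insertAt-cong (λ r′ → M≗N r′ c) i (+ 0) r

border-setColumn : ∀ i (N : Matrix k) c v →
  border i (setColumn N c v) ≗ₘ setColumn (border i N) (suc c) (λ r → insertAt v i (+ 0) r)
border-setColumn i N c v r zero    =
  sym (setColumn-≢ (border i N) (suc c) (λ r → insertAt v i (+ 0) r) r {zero} (λ ()))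
border-setColumn i N c v r (suc j) with toSum (j ≟ c)
... | inj₁ refl = trans (insertAt-cong (λ r′ → setColumn-≡ N j v r′) i (+ 0) r)
                        (sym (setColumn-≡ (border i N) (suc j) (λ r → insertAt v i (+ 0) r) r))
... | inj₂ j≢c  = trans (insertAt-cong (λ r′ → setColumn-≢ N c v r′ j≢c) i (+ 0) r)
                        (sym (setColumn-≢ (border i N) (suc c) (λ r → insertAt v i (+ 0) r) r
                                          (j≢c ∘ Finₚ.suc-injective)))

border-isAlternating : {G : Matrix (suc k) → ℤ} → IsAlternating G → ∀ i → IsAlternating (G ∘ border i)
border-isAlternating {G = G} G-alternating i = record
  { isMultilinear = record
    { resp-≗ₘ     = resp-≗ₘ ∘ border-cong i
    ; additive    = additive′
    ; homogeneous = homogeneous′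
    }
  ; equalColumns  = λ N p≢q cols≡ → equalColumns (border i N) (p≢q ∘ Finₚ.suc-injective)
                                      (λ r → insertAt-cong cols≡ i (+ 0) r)
  }
  where
  open IsAlternating G-alternating
  open ≡-Reasoning
  lift : (Fin _ → ℤ) → Fin (suc _) → ℤ
  lift v r = insertAt v i (+ 0) r
  additive′ : ∀ N c x y → G (border i (setColumn N c (λ r → x r + y r))) ≡
                          G (border i (setColumn N c x)) + G (border i (setColumn N c y))
  additive′ N c x y = begin
    G (border i (setColumn N c (λ r → x r + y r)))
      ≡⟨ resp-≗ₘ (border-setColumn i N c _) ⟩
    G (setColumn (border i N) (suc c) (lift (λ r → x r + y r)))
      ≡⟨ resp-≗ₘ (setColumn-cong (border i N) (suc c) (insertAt-zipWith _+_ x y i (+ 0) (+ 0))) ⟩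
    G (setColumn (border i N) (suc c) (λ r → lift x r + lift y r))
      ≡⟨ additive (border i N) (suc c) (lift x) (lift y) ⟩
    G (setColumn (border i N) (suc c) (lift x)) + G (setColumn (border i N) (suc c) (lift y))
      ≡⟨ sym (cong₂ _+_ (resp-≗ₘ (border-setColumn i N c x)) (resp-≗ₘ (border-setColumn i N c y))) ⟩
    G (border i (setColumn N c x)) + G (border i (setColumn N c y)) ∎
  homogeneous′ : ∀ N c a x → G (border i (setColumn N c (λ r → a * x r))) ≡ a * G (border i (setColumn N c x))
  homogeneous′ N c a x = begin
    G (border i (setColumn N c (λ r → a * x r)))
      ≡⟨ resp-≗ₘ (border-setColumn i N c _) ⟩
    G (setColumn (border i N) (suc c) (lift (λ r → a * x r)))
      ≡⟨ resp-≗ₘ (setColumn-cong (border i N) (suc c) lift-* ) ⟩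
    G (setColumn (border i N) (suc c) (λ r → a * lift x r))
      ≡⟨ homogeneous (border i N) (suc c) a (lift x) ⟩
    a * G (setColumn (border i N) (suc c) (lift x))
      ≡⟨ sym (cong (a *_) (resp-≗ₘ (border-setColumn i N c x))) ⟩
    a * G (border i (setColumn N c x)) ∎
    where
    lift-* : ∀ r → lift (λ r → a * x r) r ≡ a * lift x r
    lift-* r = trans (cong (λ z → insertAt (λ r → a * x r) i z r) (sym (ℤₚ.*-zeroʳ a)))
                     (insertAt-map (a *_) x i (+ 0) r)

border-1ₘ : ∀ (i : Fin (suc k)) r c → border i 1ₘ r (suc c) ≡ 1ₘ (punchIn i c) r
border-1ₘ i r c with toSum (i ≟ r)
... | inj₁ refl rewrite insertAt-lookup (λ r′ → 1ₘ r′ c) i (+ 0) | ==-≢ (Finₚ.punchInᵢ≢i i c) = refl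
... | inj₂ i≢r = begin
  insertAt (λ r′ → 1ₘ r′ c) i (+ 0) r     ≡⟨ insertAt-punchOut (λ r′ → 1ₘ r′ c) i (+ 0) i≢r ⟩
  indicator (punchOut i≢r == c)            ≡⟨ cong indicator (==-sym (punchOut i≢r) c) ⟩
  indicator (c == punchOut i≢r)            ≡⟨ cong indicator (punchIn-==-punchOut i≢r c) ⟨
  indicator (punchIn i c == r)             ∎
  where open ≡-Reasoning

border-zero-1ₘ : border zero 1ₘ ≗ₘ 1ₘ {suc k}
border-zero-1ₘ r zero    = cong indicator (==-sym zero r)
border-zero-1ₘ r (suc c) = trans (border-1ₘ zero r c) (cong indicator (==-sym (suc c) r))

border-suc-1ₘ : (i : Fin k) → border (suc i) 1ₘ ≗ₘ swapColumns zero (suc i) (border (inject₁ i) 1ₘ)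
border-suc-1ₘ i r zero = begin
  1ₘ (suc i) r                     ≡⟨ cong (λ j → 1ₘ j r) (punchIn-inject₁-self i) ⟨
  1ₘ (punchIn (inject₁ i) i) r     ≡⟨ border-1ₘ (inject₁ i) r i ⟨
  border (inject₁ i) 1ₘ r (suc i)  ≡⟨ cong (border (inject₁ i) 1ₘ r) (transpose-matchˡ zero (suc i)) ⟨
  swapColumns zero (suc i) (border (inject₁ i) 1ₘ) r zero ∎
  where open ≡-Reasoning
border-suc-1ₘ i r (suc c) with toSum (c ≟ i)
... | inj₁ refl = begin
  border (suc c) 1ₘ r (suc c)      ≡⟨ border-1ₘ (suc c) r c ⟩
  1ₘ (punchIn (suc c) c) r         ≡⟨ cong (λ j → 1ₘ j r) (punchIn-suc-self c) ⟩
  1ₘ (inject₁ c) r                 ≡⟨ cong (border (inject₁ c) 1ₘ r) (transpose-matchʳ zero (suc c)) ⟨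
  swapColumns zero (suc c) (border (inject₁ c) 1ₘ) r (suc c) ∎
  where open ≡-Reasoning
... | inj₂ c≢i = begin
  border (suc i) 1ₘ r (suc c)      ≡⟨ border-1ₘ (suc i) r c ⟩
  1ₘ (punchIn (suc i) c) r         ≡⟨ cong (λ j → 1ₘ j r) (punchIn-suc≡punchIn-inject₁ c≢i) ⟩
  1ₘ (punchIn (inject₁ i) c) r     ≡⟨ border-1ₘ (inject₁ i) r c ⟨
  border (inject₁ i) 1ₘ r (suc c)
    ≡⟨ cong (border (inject₁ i) 1ₘ r) (transpose-other {p = zero} (λ ()) (c≢i ∘ Finₚ.suc-injective)) ⟨
  swapColumns zero (suc i) (border (inject₁ i) 1ₘ) r (suc c) ∎
  where open ≡-Reasoning

minorᶜ : Matrix (suc k) → Fin (suc k) → Matrix k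
minorᶜ B i r c = B (punchIn i r) (suc c)

module _ {G : Matrix (suc k) → ℤ} (G-alternating : IsAlternating G) where
  open IsAlternating G-alternating

  border-1ₘ-sign : ∀ i → G (border i 1ₘ) ≡ sign i * G 1ₘ
  border-1ₘ-sign = <-weakInduction (λ i → G (border i 1ₘ) ≡ sign i * G 1ₘ)
    (trans (resp-≗ₘ border-zero-1ₘ) (sym (ℤₚ.*-identityˡ (G 1ₘ)))) step
    where
    open ≡-Reasoning
    step : ∀ i → G (border (inject₁ i) 1ₘ) ≡ sign (inject₁ i) * G 1ₘ →
                 G (border (suc i) 1ₘ) ≡ sign (suc i) * G 1ₘ
    step i ih = begin
      G (border (suc i) 1ₘ)                             ≡⟨ resp-≗ₘ (border-suc-1ₘ i) ⟩
      G (swapColumns zero (suc i) (border (inject₁ i) 1ₘ))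
        ≡⟨ swapColumns-anti isMultilinear (λ ()) (λ B → equalColumns B (λ ())) _ ⟩
      - G (border (inject₁ i) 1ₘ)                       ≡⟨ cong -_ (trans ih (cong (_* G 1ₘ) (sign-inject₁ i))) ⟩
      - (sign i * G 1ₘ)                                 ≡⟨ ℤₚ.neg-distribˡ-* (sign i) (G 1ₘ) ⟩
      - sign i * G 1ₘ                                   ∎

  replacePivotRowEntry : ∀ i E c (w : Fin (suc k) → ℤ) → (∀ r → E r zero ≡ 1ₘ i r) →
                         (∀ r → i ≢ r → w r ≡ E r (suc c)) → G (setColumn E (suc c) w) ≡ G E
  replacePivotRowEntry i E c w E₀ w≈E = begin
    G (setColumn E (suc c) w)                              ≡⟨ resp-≗ₘ (setColumn-cong E (suc c) w≗) ⟩
    G (setColumn E (suc c) (λ r → E r (suc c) + d * E r zero)) ≡⟨ addColumnMultiple E d (λ ()) ⟩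
    G E                                                    ∎
    where
    open ≡-Reasoning
    d = w i - E i (suc c)
    w≗ : ∀ r → w r ≡ E r (suc c) + d * E r zero
    w≗ r with toSum (i ≟ r)
    ... | inj₁ refl rewrite E₀ i | ==-refl i = shift (w i) (E i (suc c))
      where
      shift : ∀ a b → a ≡ b + (a - b) * + 1
      shift = solve-∀
    ... | inj₂ i≢r rewrite E₀ r | ==-≢ i≢r = begin
      w r                       ≡⟨ w≈E r i≢r ⟩
      E r (suc c)               ≡⟨ ℤₚ.+-identityʳ (E r (suc c)) ⟨
      E r (suc c) + + 0         ≡⟨ cong (_+_ (E r (suc c))) (ℤₚ.*-zeroʳ d) ⟨
      E r (suc c) + d * + 0     ∎

  -- Row i of the other columns is cleared by subtracting multiples of column 0 = e_i.
  pivotRow-irrelevant : ∀ i (E T : Matrix (suc k)) → (∀ r → E r zero ≡ 1ₘ i r) → (∀ r → T r zero ≡ 1ₘ i r) →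
                        (∀ r j → i ≢ r → E r j ≡ T r j) → G E ≡ G T
  pivotRow-irrelevant i E T E₀ T₀ E≈T = go (allFin k) E E₀ E≈T (λ c c∉ → ⊥-elim (c∉ (∈-allFin c)))
    where
    go : ∀ cs E → (∀ r → E r zero ≡ 1ₘ i r) → (∀ r j → i ≢ r → E r j ≡ T r j) →
         (∀ c → c ∉ cs → ∀ r → E r (suc c) ≡ T r (suc c)) → G E ≡ G T
    go []       E E₀ E≈T agree = resp-≗ₘ λ where
      r zero    → trans (E₀ r) (sym (T₀ r))
      r (suc c) → agree c (λ ()) r
    go (c ∷ cs) E E₀ E≈T agree = trans
      (sym (replacePivotRowEntry i E c w E₀ (λ r i≢r → sym (E≈T r (suc c) i≢r))))
      (go cs E′ E′₀ E′≈T agree′)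
      where
      w = λ r → T r (suc c)
      E′ = setColumn E (suc c) w
      E′₀ : ∀ r → E′ r zero ≡ 1ₘ i r
      E′₀ r = trans (setColumn-≢ E (suc c) w r (λ ())) (E₀ r)
      E′≈T : ∀ r j → i ≢ r → E′ r j ≡ T r j
      E′≈T r j i≢r with toSum (j ≟ suc c)
      ... | inj₁ refl = setColumn-≡ E j w r
      ... | inj₂ j≢c  = trans (setColumn-≢ E (suc c) w r j≢c) (E≈T r j i≢r)
      agree′ : ∀ c′ → c′ ∉ cs → ∀ r → E′ r (suc c′) ≡ T r (suc c′)
      agree′ c′ c′∉cs r with toSum (c′ ≟ c)
      ... | inj₁ refl = setColumn-≡ E (suc c′) w r
      ... | inj₂ c′≢c = trans (setColumn-≢ E (suc c) w r (c′≢c ∘ Finₚ.suc-injective))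
                              (agree c′ (λ where (here eq) → c′≢c eq ; (there c′∈cs) → c′∉cs c′∈cs) r)

  pivotColumn-border : ∀ B i → G (setColumn B zero (1ₘ i)) ≡ G (border i (minorᶜ B i))
  pivotColumn-border B i = pivotRow-irrelevant i _ _ (setColumn-≡ B zero (1ₘ i)) (λ _ → refl) agree
    where
    open ≡-Reasoning
    agree : ∀ r j → i ≢ r → setColumn B zero (1ₘ i) r j ≡ border i (minorᶜ B i) r j
    agree r zero    _   = setColumn-≡ B zero (1ₘ i) r
    agree r (suc c) i≢r = begin
      setColumn B zero (1ₘ i) r (suc c)        ≡⟨ setColumn-≢ B zero (1ₘ i) r (λ ()) ⟩
      B r (suc c)                              ≡⟨ cong (λ r′ → B r′ (suc c)) (Finₚ.punchIn-punchOut i≢r) ⟨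
      B (punchIn i (punchOut i≢r)) (suc c)     ≡⟨ insertAt-punchOut (λ r′ → minorᶜ B i r′ c) i (+ 0) i≢r ⟨
      border i (minorᶜ B i) r (suc c)          ∎

detᶜ : Matrix k → ℤ
detᶜ {zero}  B = + 1
detᶜ {suc k} B = altSum (λ i → B i zero * detᶜ (minorᶜ B i))

alternating-unique : {G : Matrix k → ℤ} → IsAlternating G → ∀ B → G B ≡ detᶜ B * G 1ₘ
alternating-unique {zero}  {G} G-alternating B =
  trans (IsAlternating.resp-≗ₘ G-alternating (λ ())) (sym (ℤₚ.*-identityˡ (G 1ₘ)))
alternating-unique {suc k} {G} G-alternating B = begin
  G B
    ≡⟨ resp-≗ₘ column₀-expansion ⟨
  G (setColumn B zero (λ r → ∑[ i < suc k ] (B i zero * 1ₘ i r)))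
    ≡⟨ ∑-column B zero (λ i r → B i zero * 1ₘ i r) ⟩
  ∑[ i < suc k ] G (setColumn B zero (λ r → B i zero * 1ₘ i r))
    ≡⟨ sum-cong-≗ (λ i → homogeneous B zero (B i zero) (1ₘ i)) ⟩
  ∑[ i < suc k ] (B i zero * G (setColumn B zero (1ₘ i)))
    ≡⟨ sum-cong-≗ term ⟩
  ∑[ i < suc k ] (sign i * (B i zero * detᶜ (minorᶜ B i)) * G 1ₘ)
    ≡⟨ *-distribʳ-sum (G 1ₘ) (λ i → sign i * (B i zero * detᶜ (minorᶜ B i))) ⟨
  ∑[ i < suc k ] (sign i * (B i zero * detᶜ (minorᶜ B i))) * G 1ₘ
    ≡⟨ cong (_* G 1ₘ) (altSum≡∑sign (λ i → B i zero * detᶜ (minorᶜ B i))) ⟨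
  detᶜ B * G 1ₘ ∎
  where
  open ≡-Reasoning
  open IsAlternating G-alternating
  column₀-expansion : setColumn B zero (λ r → ∑[ i < suc k ] (B i zero * 1ₘ i r)) ≗ₘ B
  column₀-expansion r j = trans (setColumn-cong B zero (∑-1ₘʳ (λ i → B i zero)) r j) (setColumn-self B zero r j)
  reorder : ∀ b d s g → b * (d * (s * g)) ≡ s * (b * d) * g
  reorder = solve-∀
  term : ∀ i → B i zero * G (setColumn B zero (1ₘ i)) ≡ sign i * (B i zero * detᶜ (minorᶜ B i)) * G 1ₘ
  term i = begin
    B i zero * G (setColumn B zero (1ₘ i))
      ≡⟨ cong (B i zero *_) (pivotColumn-border G-alternating B i) ⟩
    B i zero * G (border i (minorᶜ B i))
      ≡⟨ cong (B i zero *_) (alternating-unique (border-isAlternating G-alternating i) (minorᶜ B i)) ⟩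
    B i zero * (detᶜ (minorᶜ B i) * G (border i 1ₘ))
      ≡⟨ cong (λ g → B i zero * (detᶜ (minorᶜ B i) * g)) (border-1ₘ-sign G-alternating i) ⟩
    B i zero * (detᶜ (minorᶜ B i) * (sign i * G 1ₘ))
      ≡⟨ reorder (B i zero) (detᶜ (minorᶜ B i)) (sign i) (G 1ₘ) ⟩
    sign i * (B i zero * detᶜ (minorᶜ B i)) * G 1ₘ ∎

det-1ₘ : det (1ₘ {k}) ≡ + 1
det-1ₘ {zero}  = refl
det-1ₘ {suc k} = cong₂ _-_ (cong (+ 1 *_) (trans (det-cong (minor-1ₘ {k})) (det-1ₘ {k})))
                           (altSum-zero (λ j → ℤₚ.*-zeroˡ (det (minor (1ₘ {suc k}) (suc j)))))

det≡detᶜ : (B : Matrix k) → det B ≡ detᶜ B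
det≡detᶜ {k} B = begin
  det B             ≡⟨ alternating-unique det-isAlternating B ⟩
  detᶜ B * det (1ₘ {k}) ≡⟨ cong (detᶜ B *_) (det-1ₘ {k}) ⟩
  detᶜ B * + 1      ≡⟨ ℤₚ.*-identityʳ (detᶜ B) ⟩
  detᶜ B            ∎
  where open ≡-Reasoning

detᶜ-ᵀ : (A : Matrix k) → detᶜ (A ᵀ) ≡ det A
detᶜ-ᵀ {zero}  A = refl
detᶜ-ᵀ {suc k} A = altSum-cong (λ i → cong (A zero i *_) (detᶜ-ᵀ (minor A i)))

det-ᵀ : (A : Matrix k) → det (A ᵀ) ≡ det A
det-ᵀ A = trans (det≡detᶜ (A ᵀ)) (detᶜ-ᵀ A)

det-*ₘ-isAlternating : (A : Matrix k) → IsAlternating (λ B → det (A *ₘ B))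
det-*ₘ-isAlternating {k} A = record
  { isMultilinear = record
    { resp-≗ₘ     = λ B≗B′ → det-cong (λ r c → sum-cong-≗ (λ m → cong (A r m *_) (B≗B′ m c)))
    ; additive    = additive′
    ; homogeneous = homogeneous′
    }
  ; equalColumns  = λ B p≢q cols≡ →
      equalColumns (A *ₘ B) p≢q (λ r → sum-cong-≗ (λ m → cong (A r m *_) (cols≡ m)))
  }
  where
  open IsAlternating (det-isAlternating {k})
  open ≡-Reasoning
  additive′ : ∀ B c (x y : Fin k → ℤ) → det (A *ₘ setColumn B c (λ r → x r + y r)) ≡
                                        det (A *ₘ setColumn B c x) + det (A *ₘ setColumn B c y)
  additive′ B c x y = begin
    det (A *ₘ setColumn B c (λ r → x r + y r))
      ≡⟨ det-cong (*ₘ-setColumn A B c _) ⟩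
    det (setColumn (A *ₘ B) c (A *ᵥ (λ r → x r + y r)))
      ≡⟨ det-cong (setColumn-cong (A *ₘ B) c distrib) ⟩
    det (setColumn (A *ₘ B) c (λ r → (A *ᵥ x) r + (A *ᵥ y) r))
      ≡⟨ additive (A *ₘ B) c (A *ᵥ x) (A *ᵥ y) ⟩
    det (setColumn (A *ₘ B) c (A *ᵥ x)) + det (setColumn (A *ₘ B) c (A *ᵥ y))
      ≡⟨ sym (cong₂ _+_ (det-cong (*ₘ-setColumn A B c x)) (det-cong (*ₘ-setColumn A B c y))) ⟩
    det (A *ₘ setColumn B c x) + det (A *ₘ setColumn B c y) ∎
    where
    distrib : ∀ r → (A *ᵥ (λ r → x r + y r)) r ≡ (A *ᵥ x) r + (A *ᵥ y) r
    distrib r = trans (sum-cong-≗ (λ m → ℤₚ.*-distribˡ-+ (A r m) (x m) (y m)))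
                      (∑-distrib-+ (λ m → A r m * x m) (λ m → A r m * y m))
  homogeneous′ : ∀ B c a (x : Fin k → ℤ) →
                 det (A *ₘ setColumn B c (λ r → a * x r)) ≡ a * det (A *ₘ setColumn B c x)
  homogeneous′ B c a x = begin
    det (A *ₘ setColumn B c (λ r → a * x r))
      ≡⟨ det-cong (*ₘ-setColumn A B c _) ⟩
    det (setColumn (A *ₘ B) c (A *ᵥ (λ r → a * x r)))
      ≡⟨ det-cong (setColumn-cong (A *ₘ B) c pull) ⟩
    det (setColumn (A *ₘ B) c (λ r → a * (A *ᵥ x) r))
      ≡⟨ homogeneous (A *ₘ B) c a (A *ᵥ x) ⟩
    a * det (setColumn (A *ₘ B) c (A *ᵥ x))
      ≡⟨ sym (cong (a *_) (det-cong (*ₘ-setColumn A B c x))) ⟩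
    a * det (A *ₘ setColumn B c x) ∎
    where
    swap-* : ∀ b a d → b * (a * d) ≡ a * (b * d)
    swap-* = solve-∀
    pull : ∀ r → (A *ᵥ (λ r → a * x r)) r ≡ a * (A *ᵥ x) r
    pull r = trans (sum-cong-≗ (λ m → swap-* (A r m) a (x m))) (sym (*-distribˡ-sum a (λ m → A r m * x m)))

det-*ₘ : (A B : Matrix k) → det (A *ₘ B) ≡ det A * det B
det-*ₘ A B = begin
  det (A *ₘ B)             ≡⟨ alternating-unique (det-*ₘ-isAlternating A) B ⟩
  detᶜ B * det (A *ₘ 1ₘ)   ≡⟨ cong₂ _*_ (sym (det≡detᶜ B)) (det-cong (*ₘ-1ₘ A)) ⟩
  det B * det A            ≡⟨ ℤₚ.*-comm (det B) (det A) ⟩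
  det A * det B            ∎
  where open ≡-Reasoning

det-reindex : ∀ {m n} → m ≡ n → (T : Matrix n) (φ : Fin m → Fin n) → (∀ {x y} → φ x ≡ φ y → x ≡ y) →
              det (λ r c → T (φ r) (φ c)) ≡ det T
det-reindex {n = n} refl T φ φ-inj = begin
  det (λ r c → T (φ r) (φ c))   ≡⟨ det-cong (λ r c → sym (Q*T*P r c)) ⟩
  det (Q *ₘ (T *ₘ P))           ≡⟨ det-*ₘ Q (T *ₘ P) ⟩
  det Q * det (T *ₘ P)          ≡⟨ cong (det Q *_) (det-*ₘ T P) ⟩
  det Q * (det T * det P)       ≡⟨ swap-* (det Q) (det T) (det P) ⟩
  det T * (det Q * det P)       ≡⟨ cong (det T *_) (sym (det-*ₘ Q P)) ⟩
  det T * det (Q *ₘ P)          ≡⟨ cong (det T *_) (trans (det-cong Q*P) (det-1ₘ {n})) ⟩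
  det T * + 1                   ≡⟨ ℤₚ.*-identityʳ (det T) ⟩
  det T                         ∎
  where
  open ≡-Reasoning
  P Q : Matrix n
  P l c = 1ₘ l (φ c)
  Q r l = 1ₘ (φ r) l
  swap-* : ∀ q t p → q * (t * p) ≡ t * (q * p)
  swap-* = solve-∀
  Q*T*P : ∀ r c → (Q *ₘ (T *ₘ P)) r c ≡ T (φ r) (φ c)
  Q*T*P r c = trans (∑-1ₘˡ (λ m → (T *ₘ P) m c) (φ r)) (∑-1ₘʳ (T (φ r)) (φ c))
  Q*P : Q *ₘ P ≗ₘ 1ₘ
  Q*P r c = trans (∑-1ₘˡ (λ m → 1ₘ m (φ c)) (φ r)) (cong indicator (==-injective φ φ-inj r c))

det-blockLower : ∀ a {b} (M : Matrix (a ℕ.+ b)) (X : Matrix a) (Z : Matrix b) →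
  (∀ r c → M (r ↑ˡ b) (c ↑ˡ b) ≡ X r c) → (∀ r c → M (r ↑ˡ b) (a ↑ʳ c) ≡ + 0) →
  (∀ r c → M (a ↑ʳ r) (a ↑ʳ c) ≡ Z r c) → det M ≡ det X * det Z
det-blockLower zero    M X Z _ _ M≈Z = trans (det-cong M≈Z) (sym (ℤₚ.*-identityˡ (det Z)))
det-blockLower (suc a) {b} M X Z M≈X M≈0 M≈Z = begin
  altSum (laplaceTerm M)                          ≡⟨ altSum-↑ˡ (suc a) (laplaceTerm M) right≡0 ⟩
  altSum (λ j → laplaceTerm M (j ↑ˡ b))           ≡⟨ altSum-cong left≡ ⟩
  altSum (λ j → laplaceTerm X j * det Z)          ≡⟨ altSum-*ʳ (det Z) (laplaceTerm X) ⟩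
  altSum (laplaceTerm X) * det Z                  ∎
  where
  open ≡-Reasoning
  right≡0 : ∀ c → laplaceTerm M (suc a ↑ʳ c) ≡ + 0
  right≡0 c = trans (cong (_* det (minor M (suc a ↑ʳ c))) (M≈0 zero c))
                    (ℤₚ.*-zeroˡ (det (minor M (suc a ↑ʳ c))))
  left≡ : ∀ j → laplaceTerm M (j ↑ˡ b) ≡ laplaceTerm X j * det Z
  left≡ j = trans (cong₂ _*_ (M≈X zero j) (det-blockLower a (minor M (j ↑ˡ b)) (minor X j) Z
      (λ r c → trans (cong (M (suc (r ↑ˡ b))) (punchIn-↑ˡ b j c)) (M≈X (suc r) (punchIn j c)))
      (λ r c → trans (cong (M (suc (r ↑ˡ b))) (punchIn-↑ʳ b j c)) (M≈0 (suc r) c))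
      (λ r c → trans (cong (M (suc (a ↑ʳ r))) (punchIn-↑ʳ b j c)) (M≈Z r c))))
    (sym (ℤₚ.*-assoc (X zero j) _ _))

det-blockUnitriangular : ∀ {m} (Y : Matrix m) → det (block 1ₘ Y 0ₘ 1ₘ) ≡ + 1
det-blockUnitriangular {m} Y = begin
  det (block 1ₘ Y 0ₘ 1ₘ)        ≡⟨ det-ᵀ (block 1ₘ Y 0ₘ 1ₘ) ⟨
  det (block 1ₘ Y 0ₘ 1ₘ ᵀ)      ≡⟨ det-blockLower m (block 1ₘ Y 0ₘ 1ₘ ᵀ) 1ₘ 1ₘ
                                     (λ r c → trans (block-↑ˡ↑ˡ 1ₘ Y 0ₘ 1ₘ c r) (cong indicator (==-sym c r)))
                                     (λ r c → block-↑ʳ↑ˡ 1ₘ Y 0ₘ 1ₘ c r)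
                                     (λ r c → trans (block-↑ʳ↑ʳ 1ₘ Y 0ₘ 1ₘ c r) (cong indicator (==-sym c r))) ⟩
  det (1ₘ {m}) * det (1ₘ {m})   ≡⟨ cong₂ _*_ (det-1ₘ {m}) (det-1ₘ {m}) ⟩
  + 1                           ∎
  where open ≡-Reasoning

module _ {m : ℕ} where

  private
    -1ₘ : Matrix m
    -1ₘ i j = - 1ₘ i j

  blockRowAdd blockColumnSub : Matrix (m ℕ.+ m)
  blockRowAdd    = block {m} 1ₘ 1ₘ 0ₘ 1ₘ
  blockColumnSub = block {m} 1ₘ -1ₘ 0ₘ 1ₘ

  blockRowAdd-*ₘ-↑ˡ : ∀ (X : Matrix (m ℕ.+ m)) k c →
                      (blockRowAdd *ₘ X) (k ↑ˡ m) c ≡ X (k ↑ˡ m) c + X (m ↑ʳ k) c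
  blockRowAdd-*ₘ-↑ˡ X k c = trans (∑-↑ m (λ l → blockRowAdd (k ↑ˡ m) l * X l c)) (cong₂ _+_
    (trans (sum-cong-≗ (λ i → cong (_* X (i ↑ˡ m) c) (block-↑ˡ↑ˡ 1ₘ 1ₘ 0ₘ 1ₘ k i)))
           (∑-1ₘˡ (λ i → X (i ↑ˡ m) c) k))
    (trans (sum-cong-≗ (λ i → cong (_* X (m ↑ʳ i) c) (block-↑ˡ↑ʳ 1ₘ 1ₘ 0ₘ 1ₘ k i)))
           (∑-1ₘˡ (λ i → X (m ↑ʳ i) c) k)))

  blockRowAdd-*ₘ-↑ʳ : ∀ (X : Matrix (m ℕ.+ m)) k c → (blockRowAdd *ₘ X) (m ↑ʳ k) c ≡ X (m ↑ʳ k) c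
  blockRowAdd-*ₘ-↑ʳ X k c = trans (∑-↑ m (λ l → blockRowAdd (m ↑ʳ k) l * X l c)) (trans (cong₂ _+_
    (∑-zero (λ i → trans (cong (_* X (i ↑ˡ m) c) (block-↑ʳ↑ˡ 1ₘ 1ₘ 0ₘ 1ₘ k i)) (ℤₚ.*-zeroˡ (X (i ↑ˡ m) c))))
    (trans (sum-cong-≗ (λ i → cong (_* X (m ↑ʳ i) c) (block-↑ʳ↑ʳ 1ₘ 1ₘ 0ₘ 1ₘ k i)))
           (∑-1ₘˡ (λ i → X (m ↑ʳ i) c) k)))
    (ℤₚ.+-identityˡ _))

  *ₘ-blockColumnSub-↑ˡ : ∀ (X : Matrix (m ℕ.+ m)) r j → (X *ₘ blockColumnSub) r (j ↑ˡ m) ≡ X r (j ↑ˡ m)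
  *ₘ-blockColumnSub-↑ˡ X r j = begin
    (X *ₘ blockColumnSub) r (j ↑ˡ m)
      ≡⟨ ∑-↑ m (λ l → X r l * blockColumnSub l (j ↑ˡ m)) ⟩
    ∑[ i < m ] (X r (i ↑ˡ m) * blockColumnSub (i ↑ˡ m) (j ↑ˡ m)) +
    ∑[ i < m ] (X r (m ↑ʳ i) * blockColumnSub (m ↑ʳ i) (j ↑ˡ m))
      ≡⟨ cong₂ _+_ (sum-cong-≗ (λ i → cong (X r (i ↑ˡ m) *_) (block-↑ˡ↑ˡ 1ₘ -1ₘ 0ₘ 1ₘ i j)))
                   (∑-zero (λ i → trans (cong (X r (m ↑ʳ i) *_) (block-↑ʳ↑ˡ 1ₘ -1ₘ 0ₘ 1ₘ i j))
                                        (ℤₚ.*-zeroʳ (X r (m ↑ʳ i))))) ⟩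
    ∑[ i < m ] (X r (i ↑ˡ m) * 1ₘ i j) + + 0   ≡⟨ cong (_+ + 0) (∑-1ₘʳ (λ i → X r (i ↑ˡ m)) j) ⟩
    X r (j ↑ˡ m) + + 0                         ≡⟨ ℤₚ.+-identityʳ _ ⟩
    X r (j ↑ˡ m)                               ∎
    where open ≡-Reasoning

  *ₘ-blockColumnSub-↑ʳ : ∀ (X : Matrix (m ℕ.+ m)) r j →
                         (X *ₘ blockColumnSub) r (m ↑ʳ j) ≡ - X r (j ↑ˡ m) + X r (m ↑ʳ j)
  *ₘ-blockColumnSub-↑ʳ X r j = begin
    (X *ₘ blockColumnSub) r (m ↑ʳ j)
      ≡⟨ ∑-↑ m (λ l → X r l * blockColumnSub l (m ↑ʳ j)) ⟩
    ∑[ i < m ] (X r (i ↑ˡ m) * blockColumnSub (i ↑ˡ m) (m ↑ʳ j)) +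
    ∑[ i < m ] (X r (m ↑ʳ i) * blockColumnSub (m ↑ʳ i) (m ↑ʳ j))
      ≡⟨ cong₂ _+_ (sum-cong-≗ (λ i → trans (cong (X r (i ↑ˡ m) *_) (block-↑ˡ↑ʳ 1ₘ -1ₘ 0ₘ 1ₘ i j))
                                             (sym (ℤₚ.neg-distribʳ-* (X r (i ↑ˡ m)) (1ₘ i j)))))
                   (sum-cong-≗ (λ i → cong (X r (m ↑ʳ i) *_) (block-↑ʳ↑ʳ 1ₘ -1ₘ 0ₘ 1ₘ i j))) ⟩
    ∑[ i < m ] (- (X r (i ↑ˡ m) * 1ₘ i j)) + ∑[ i < m ] (X r (m ↑ʳ i) * 1ₘ i j)
      ≡⟨ cong (_+ ∑[ i < m ] (X r (m ↑ʳ i) * 1ₘ i j)) (neg-∑ (λ i → X r (i ↑ˡ m) * 1ₘ i j)) ⟨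
    - ∑[ i < m ] (X r (i ↑ˡ m) * 1ₘ i j) + ∑[ i < m ] (X r (m ↑ʳ i) * 1ₘ i j)
      ≡⟨ cong₂ (λ x y → - x + y) (∑-1ₘʳ (λ i → X r (i ↑ˡ m)) j) (∑-1ₘʳ (λ i → X r (m ↑ʳ i)) j) ⟩
    - X r (j ↑ˡ m) + X r (m ↑ʳ j) ∎
    where open ≡-Reasoning

  -- blockRowAdd *ₘ [[P, Q], [Q, P]] *ₘ blockColumnSub = [[P + Q, 0], [Q, P - Q]]
  det-symmetricBlock : ∀ (M : Matrix (m ℕ.+ m)) (P Q : Matrix m) →
    (∀ i j → M (i ↑ˡ m) (j ↑ˡ m) ≡ P i j) → (∀ i j → M (i ↑ˡ m) (m ↑ʳ j) ≡ Q i j) →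
    (∀ i j → M (m ↑ʳ i) (j ↑ˡ m) ≡ Q i j) → (∀ i j → M (m ↑ʳ i) (m ↑ʳ j) ≡ P i j) →
    det M ≡ det (λ i j → P i j + Q i j) * det (λ i j → P i j - Q i j)
  det-symmetricBlock M P Q M≈P M≈Q M≈Q′ M≈P′ = begin
    det M                  ≡⟨ unimodular ⟨
    det (R *ₘ (M *ₘ C))    ≡⟨ det-blockLower m (R *ₘ (M *ₘ C)) _ _ upperLeft upperRight lowerRight ⟩
    det (λ i j → P i j + Q i j) * det (λ i j → P i j - Q i j) ∎
    where
    open ≡-Reasoning
    R = blockRowAdd
    C = blockColumnSub
    unimodular : det (R *ₘ (M *ₘ C)) ≡ det M
    unimodular = begin
      det (R *ₘ (M *ₘ C))        ≡⟨ det-*ₘ R (M *ₘ C) ⟩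
      det R * det (M *ₘ C)       ≡⟨ cong₂ _*_ (det-blockUnitriangular {m} 1ₘ) (det-*ₘ M C) ⟩
      + 1 * (det M * det C)      ≡⟨ ℤₚ.*-identityˡ _ ⟩
      det M * det C              ≡⟨ cong (det M *_) (det-blockUnitriangular -1ₘ) ⟩
      det M * + 1                ≡⟨ ℤₚ.*-identityʳ (det M) ⟩
      det M                      ∎
    -Q+P : ∀ k j → - M (m ↑ʳ k) (j ↑ˡ m) + M (m ↑ʳ k) (m ↑ʳ j) ≡ - Q k j + P k j
    -Q+P k j = cong₂ (λ x y → - x + y) (M≈Q′ k j) (M≈P′ k j)
    upperLeft : ∀ k j → (R *ₘ (M *ₘ C)) (k ↑ˡ m) (j ↑ˡ m) ≡ P k j + Q k j
    upperLeft k j = trans (blockRowAdd-*ₘ-↑ˡ (M *ₘ C) k (j ↑ˡ m))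
      (cong₂ _+_ (trans (*ₘ-blockColumnSub-↑ˡ M (k ↑ˡ m) j) (M≈P k j))
                 (trans (*ₘ-blockColumnSub-↑ˡ M (m ↑ʳ k) j) (M≈Q′ k j)))
    upperRight : ∀ k j → (R *ₘ (M *ₘ C)) (k ↑ˡ m) (m ↑ʳ j) ≡ + 0
    upperRight k j = begin
      (R *ₘ (M *ₘ C)) (k ↑ˡ m) (m ↑ʳ j)                  ≡⟨ blockRowAdd-*ₘ-↑ˡ (M *ₘ C) k (m ↑ʳ j) ⟩
      (M *ₘ C) (k ↑ˡ m) (m ↑ʳ j) + (M *ₘ C) (m ↑ʳ k) (m ↑ʳ j)
        ≡⟨ cong₂ _+_ (trans (*ₘ-blockColumnSub-↑ʳ M (k ↑ˡ m) j) (cong₂ (λ x y → - x + y) (M≈P k j) (M≈Q k j)))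
                     (trans (*ₘ-blockColumnSub-↑ʳ M (m ↑ʳ k) j) (-Q+P k j)) ⟩
      (- P k j + Q k j) + (- Q k j + P k j)              ≡⟨ cancel (P k j) (Q k j) ⟩
      + 0                                                ∎
      where
      cancel : ∀ p q → (- p + q) + (- q + p) ≡ + 0
      cancel = solve-∀
    lowerRight : ∀ k j → (R *ₘ (M *ₘ C)) (m ↑ʳ k) (m ↑ʳ j) ≡ P k j - Q k j
    lowerRight k j = begin
      (R *ₘ (M *ₘ C)) (m ↑ʳ k) (m ↑ʳ j)            ≡⟨ blockRowAdd-*ₘ-↑ʳ (M *ₘ C) k (m ↑ʳ j) ⟩
      (M *ₘ C) (m ↑ʳ k) (m ↑ʳ j)                   ≡⟨ *ₘ-blockColumnSub-↑ʳ M (m ↑ʳ k) j ⟩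
      - M (m ↑ʳ k) (j ↑ˡ m) + M (m ↑ʳ k) (m ↑ʳ j)  ≡⟨ -Q+P k j ⟩
      - Q k j + P k j                              ≡⟨ ℤₚ.+-comm (- Q k j) (P k j) ⟩
      P k j - Q k j                                ∎

oneOf : Bool → Bool → ℤ
oneOf b₁ b₂ = indicator (not (b₁ ∧ b₂) ∧ (b₁ ∨ b₂))

oneOf-comm : ∀ b₁ b₂ → oneOf b₁ b₂ ≡ oneOf b₂ b₁
oneOf-comm b₁ b₂ = cong₂ (λ b b′ → indicator (not b ∧ b′)) (∧-comm b₁ b₂) (∨-comm b₁ b₂)

-- adjHL G i j unfolds to dartAdj (lookup (darts G) i) (lookup (darts G) j).
dartAdj : ∀ {n} → Fin n × Fin n → Fin n × Fin n → ℤ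
dartAdj (u , v) (x , y) = oneOf (u == x) (v == y)

dartAdj-swapˡ : ∀ {n} (a b : Fin n × Fin n) → dartAdj (swap a) b ≡ dartAdj a (swap b)
dartAdj-swapˡ (u , v) (x , y) = oneOf-comm (v == x) (u == y)

dartAdj-swap² : ∀ {n} (a b : Fin n × Fin n) → dartAdj (swap a) (swap b) ≡ dartAdj a b
dartAdj-swap² (u , v) (x , y) = oneOf-comm (v == y) (u == x)

∧-false : ∀ {b c} → (b ≡ true → c ≡ true → ⊥) → b ∧ c ≡ false
∧-false {true}  {true}  contra = ⊥-elim (contra refl refl)
∧-false {true}  {false} _      = refl
∧-false {false}         _      = refl

-- For oriented edges (u, v) and (x, y) take b₁ = (u == x), b₂ = (v == y), b₃ = (u == y), b₄ = (v == x);
-- the right-hand sides are then the entries of adjL and antiM.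
oneOf-± : ∀ b₁ b₂ b₃ b₄ → b₁ ∧ b₃ ≡ false → b₁ ∧ b₄ ≡ false → b₂ ∧ b₃ ≡ false → b₂ ∧ b₄ ≡ false →
  b₃ ∧ b₄ ≡ false →
  oneOf b₁ b₂ + oneOf b₃ b₄ ≡ indicator (not (b₁ ∧ b₂) ∧ (b₁ ∨ b₃ ∨ b₄ ∨ b₂)) ×
  oneOf b₁ b₂ - oneOf b₃ b₄ ≡ (if (b₁ ∧ not b₂) ∨ (b₂ ∧ not b₁) then + 1
                               else if (b₃ ∧ not b₄) ∨ (b₄ ∧ not b₃) then -1ℤ else + 0)
oneOf-± false false false false _ _ _ _ _  = refl , refl
oneOf-± false true  false false _ _ _ _ _  = refl , refl
oneOf-± true  false false false _ _ _ _ _  = refl , refl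
oneOf-± true  true  false false _ _ _ _ _  = refl , refl
oneOf-± false false true  false _ _ _ _ _  = refl , refl
oneOf-± false false false true  _ _ _ _ _  = refl , refl
oneOf-± _     _     true  true  _ _ _ _ ()
oneOf-± true  _     true  false () _ _ _ _
oneOf-± true  _     false true  _ () _ _ _
oneOf-± false true  true  false _ _ () _ _
oneOf-± false true  false true  _ _ _ () _

lookup-injective : {A : Set} {xs : List A} → Unique xs → ∀ {i j} → lookup xs i ≡ lookup xs j → i ≡ j
lookup-injective (_   ∷ _) {zero}  {zero}  _  = refl
lookup-injective (x∉ ∷ _) {zero}  {suc j} eq = ⊥-elim (All.lookup x∉ (∈-lookup j) eq)
lookup-injective (x∉ ∷ _) {suc i} {zero}  eq = ⊥-elim (All.lookup x∉ (∈-lookup i) (sym eq))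
lookup-injective (_  ∷ u) {suc i} {suc j} eq = cong suc (lookup-injective u eq)

concatMap-cartesianProduct : {A B : Set} (xs : List A) (ys : List B) →
  concatMap (λ x → map (λ y → (x , y)) ys) xs ≡ cartesianProduct xs ys
concatMap-cartesianProduct []       ys = refl
concatMap-cartesianProduct (x ∷ xs) ys = cong (map (x ,_) ys ++_) (concatMap-cartesianProduct xs ys)

module _ (G : SimpleGraph) where

  private
    V : Set
    V = Fin (n G)

    allPairs : List (V × V)
    allPairs = cartesianProduct (allFin (n G)) (allFin (n G))

    allPairs-unique : Unique allPairs
    allPairs-unique = Uniqueₚ.cartesianProduct⁺ (Uniqueₚ.allFin⁺ (n G)) (Uniqueₚ.allFin⁺ (n G))

    ∈-allPairs : ∀ u v → (u , v) ∈ allPairs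
    ∈-allPairs u v = ∈-cartesianProduct⁺ (∈-allFin u) (∈-allFin v)

    isDart isEdge : V × V → Bool
    isDart (u , v) = adj G u v
    isEdge (u , v) = adj G u v ∧ (toℕ u <ᵇ toℕ v)

    darts≡ : darts G ≡ filterᵇ isDart allPairs
    darts≡ = cong (filterᵇ isDart) (concatMap-cartesianProduct (allFin (n G)) (allFin (n G)))

    edges≡ : edges G ≡ filterᵇ isEdge allPairs
    edges≡ = cong (filterᵇ isEdge) (concatMap-cartesianProduct (allFin (n G)) (allFin (n G)))

  darts-unique : Unique (darts G)
  darts-unique rewrite darts≡ = Uniqueₚ.filter⁺ (T? ∘ isDart) allPairs-unique

  edges-unique : Unique (edges G)
  edges-unique rewrite edges≡ = Uniqueₚ.filter⁺ (T? ∘ isEdge) allPairs-unique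

  ∈-darts⁺ : ∀ {u v} → adj G u v ≡ true → (u , v) ∈ darts G
  ∈-darts⁺ {u} {v} uv rewrite darts≡ = ∈-filter⁺ (T? ∘ isDart) (∈-allPairs u v) (Equivalence.from T-≡ uv)

  ∈-darts⁻ : ∀ {u v} → (u , v) ∈ darts G → adj G u v ≡ true
  ∈-darts⁻ uv∈ rewrite darts≡ = Equivalence.to T-≡ (proj₂ (∈-filter⁻ (T? ∘ isDart) {xs = allPairs} uv∈))

  ∈-edges⁺ : ∀ {u v} → adj G u v ≡ true → toℕ u ℕ.< toℕ v → (u , v) ∈ edges G
  ∈-edges⁺ {u} {v} uv u<v rewrite edges≡ =
    ∈-filter⁺ (T? ∘ isEdge) (∈-allPairs u v)
              (Equivalence.from T-∧ (Equivalence.from T-≡ uv , ℕₚ.<⇒<ᵇ u<v))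

  ∈-edges⁻ : ∀ {u v} → (u , v) ∈ edges G → adj G u v ≡ true × toℕ u ℕ.< toℕ v
  ∈-edges⁻ {u} {v} uv∈ rewrite edges≡
    with Equivalence.to T-∧ (proj₂ (∈-filter⁻ (T? ∘ isEdge) {xs = allPairs} uv∈))
  ... | uv , u<v = Equivalence.to T-≡ uv , ℕₚ.<ᵇ⇒< (toℕ u) (toℕ v) u<v

  private
    m : ℕ
    m = length (edges G)

  edge : Fin m → V × V
  edge = lookup (edges G)

  edge-adj : ∀ i → adj G (proj₁ (edge i)) (proj₂ (edge i)) ≡ true
  edge-adj i = proj₁ (∈-edges⁻ (∈-lookup i))

  edge-< : ∀ i → toℕ (proj₁ (edge i)) ℕ.< toℕ (proj₂ (edge i))
  edge-< i = proj₂ (∈-edges⁻ (∈-lookup i))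

  edge≢swap : ∀ i j → edge i ≢ swap (edge j)
  edge≢swap i j eq = ℕₚ.<-asym (edge-< j)
    (subst₂ (λ a b → toℕ a ℕ.< toℕ b) (cong proj₁ eq) (cong proj₂ eq) (edge-< i))

  orientedDart : Fin m ⊎ Fin m → V × V
  orientedDart = [ edge , swap ∘ edge ]′

  orientedDart-injective : ∀ {x y} → orientedDart x ≡ orientedDart y → x ≡ y
  orientedDart-injective {inj₁ i} {inj₁ j} eq = cong inj₁ (lookup-injective edges-unique eq)
  orientedDart-injective {inj₁ i} {inj₂ j} eq = ⊥-elim (edge≢swap i j eq)
  orientedDart-injective {inj₂ i} {inj₁ j} eq = ⊥-elim (edge≢swap j i (sym eq))
  orientedDart-injective {inj₂ i} {inj₂ j} eq = cong inj₂ (lookup-injective edges-unique (cong swap eq))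

  dart : Fin (m ℕ.+ m) → V × V
  dart = orientedDart ∘ splitAt m

  dart-↑ˡ : ∀ i → dart (i ↑ˡ m) ≡ edge i
  dart-↑ˡ i = cong orientedDart (Finₚ.splitAt-↑ˡ m i m)

  dart-↑ʳ : ∀ i → dart (m ↑ʳ i) ≡ swap (edge i)
  dart-↑ʳ i = cong orientedDart (Finₚ.splitAt-↑ʳ m m i)

  dart-injective : ∀ {x y} → dart x ≡ dart y → x ≡ y
  dart-injective {x} {y} eq = begin
    x                         ≡⟨ Finₚ.join-splitAt m m x ⟨
    join m m (splitAt m x)    ≡⟨ cong (join m m) (orientedDart-injective {splitAt m x} {splitAt m y} eq) ⟩
    join m m (splitAt m y)    ≡⟨ Finₚ.join-splitAt m m y ⟩
    y                         ∎
    where open ≡-Reasoning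

  dart∈darts : ∀ x → dart x ∈ darts G
  dart∈darts x with splitAt m x
  ... | inj₁ i = ∈-darts⁺ (edge-adj i)
  ... | inj₂ i = ∈-darts⁺ (trans (symm G _ _) (edge-adj i))

  dartIndex : Fin (m ℕ.+ m) → Fin (length (darts G))
  dartIndex x = Any.index (dart∈darts x)

  lookup-dartIndex : ∀ x → lookup (darts G) (dartIndex x) ≡ dart x
  lookup-dartIndex x = sym (Anyₚ.lookup-index (dart∈darts x))

  dartIndex-injective : ∀ {x y} → dartIndex x ≡ dartIndex y → x ≡ y
  dartIndex-injective {x} {y} eq =
    dart-injective (trans (sym (lookup-dartIndex x)) (trans (cong (lookup (darts G)) eq) (lookup-dartIndex y)))

  dart-surjective : ∀ d → Σ (Fin (m ℕ.+ m)) λ x → dart x ≡ lookup (darts G) d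
  dart-surjective d with lookup (darts G) d in eq
  ... | u , v with ∈-darts⁻ (subst (_∈ darts G) eq (∈-lookup d)) | ℕₚ.<-cmp (toℕ u) (toℕ v)
  ...   | uv | tri< u<v _ _ = let i = Any.index (∈-edges⁺ uv u<v) in
    i ↑ˡ m , trans (dart-↑ˡ i) (sym (Anyₚ.lookup-index (∈-edges⁺ uv u<v)))
  ...   | uv | tri≈ _ u≡v _
    with () ← trans (sym uv) (trans (cong (adj G u) (sym (Finₚ.toℕ-injective u≡v))) (irrefl G u))
  ...   | uv | tri> _ _ v<u = let vu = trans (symm G v u) uv ; i = Any.index (∈-edges⁺ vu v<u) in
    m ↑ʳ i , trans (dart-↑ʳ i) (cong swap (sym (Anyₚ.lookup-index (∈-edges⁺ vu v<u))))

  length-darts : m ℕ.+ m ≡ length (darts G)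
  length-darts = Finₚ.cantor-schröder-bernstein dartIndex-injective preimage-injective
    where
    preimage-injective : ∀ {d d′} → proj₁ (dart-surjective d) ≡ proj₁ (dart-surjective d′) → d ≡ d′
    preimage-injective {d} {d′} eq = lookup-injective darts-unique (begin
      lookup (darts G) d                    ≡⟨ proj₂ (dart-surjective d) ⟨
      dart (proj₁ (dart-surjective d))      ≡⟨ cong dart eq ⟩
      dart (proj₁ (dart-surjective d′))     ≡⟨ proj₂ (dart-surjective d′) ⟩
      lookup (darts G) d′                   ∎)
      where open ≡-Reasoning

  module _ (i j : Fin m) where
    private
      u = proj₁ (edge i)
      v = proj₂ (edge i)
      x = proj₁ (edge j)
      y = proj₂ (edge j)
      u<v = edge-< i
      x<y = edge-< j
      edgeAdj-± = oneOf-± (u == x) (v == y) (u == y) (v == x)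
        (∧-false {u == x} {u == y} λ ux uy → ℕₚ.<-irrefl (cong toℕ (trans (sym (==⇒≡ ux)) (==⇒≡ uy))) x<y)
        (∧-false {u == x} {v == x} λ ux vx → ℕₚ.<-irrefl (cong toℕ (trans (==⇒≡ ux) (sym (==⇒≡ vx)))) u<v)
        (∧-false {v == y} {u == y} λ vy uy → ℕₚ.<-irrefl (cong toℕ (trans (==⇒≡ uy) (sym (==⇒≡ vy)))) u<v)
        (∧-false {v == y} {v == x} λ vy vx → ℕₚ.<-irrefl (cong toℕ (trans (sym (==⇒≡ vx)) (==⇒≡ vy))) x<y)
        (∧-false {u == y} {v == x} λ uy vx →
          ℕₚ.<-asym (subst₂ (λ a b → toℕ a ℕ.< toℕ b) (==⇒≡ uy) (==⇒≡ vx) u<v) x<y)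

    dartAdj-edge-+ : dartAdj (edge i) (edge j) + dartAdj (edge i) (swap (edge j)) ≡ adjL G i j
    dartAdj-edge-+ = proj₁ edgeAdj-±

    dartAdj-edge-- : dartAdj (edge i) (edge j) - dartAdj (edge i) (swap (edge j)) ≡ antiM G i j
    dartAdj-edge-- = proj₂ edgeAdj-±

  crossBlock : Matrix m
  crossBlock i j = - dartAdj (edge i) (swap (edge j))

  module _ (t : ℤ) where

    charHL : Matrix (m ℕ.+ m)
    charHL r c = (t ·1ₘ) (dartIndex r) (dartIndex c) - adjHL G (dartIndex r) (dartIndex c)

    sameBlock : Matrix m
    sameBlock i j = (t ·1ₘ) i j - dartAdj (edge i) (edge j)

    charHL-dart : ∀ r c → charHL r c ≡ (t ·1ₘ) r c - dartAdj (dart r) (dart c)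
    charHL-dart r c = cong₂ _-_ (·1ₘ-injective t dartIndex dartIndex-injective r c)
                                (cong₂ dartAdj (lookup-dartIndex r) (lookup-dartIndex c))

    charHL-↑ˡ↑ˡ : ∀ i j → charHL (i ↑ˡ m) (j ↑ˡ m) ≡ sameBlock i j
    charHL-↑ˡ↑ˡ i j = trans (charHL-dart (i ↑ˡ m) (j ↑ˡ m))
      (cong₂ _-_ (·1ₘ-injective t (_↑ˡ m) (Finₚ.↑ˡ-injective m _ _) i j)
                 (cong₂ dartAdj (dart-↑ˡ i) (dart-↑ˡ j)))

    charHL-↑ˡ↑ʳ : ∀ i j → charHL (i ↑ˡ m) (m ↑ʳ j) ≡ crossBlock i j
    charHL-↑ˡ↑ʳ i j = trans (charHL-dart (i ↑ˡ m) (m ↑ʳ j))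
      (trans (cong₂ _-_ (·1ₘ-↑ˡ↑ʳ t i j) (cong₂ dartAdj (dart-↑ˡ i) (dart-↑ʳ j))) (ℤₚ.+-identityˡ _))

    charHL-↑ʳ↑ˡ : ∀ i j → charHL (m ↑ʳ i) (j ↑ˡ m) ≡ crossBlock i j
    charHL-↑ʳ↑ˡ i j = trans (charHL-dart (m ↑ʳ i) (j ↑ˡ m))
      (trans (cong₂ _-_ (trans (·1ₘ-sym t (m ↑ʳ i) (j ↑ˡ m)) (·1ₘ-↑ˡ↑ʳ t j i))
                        (trans (cong₂ dartAdj (dart-↑ʳ i) (dart-↑ˡ j)) (dartAdj-swapˡ (edge i) (edge j))))
             (ℤₚ.+-identityˡ _))

    charHL-↑ʳ↑ʳ : ∀ i j → charHL (m ↑ʳ i) (m ↑ʳ j) ≡ sameBlock i j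
    charHL-↑ʳ↑ʳ i j = trans (charHL-dart (m ↑ʳ i) (m ↑ʳ j))
      (cong₂ _-_ (·1ₘ-injective t (m ↑ʳ_) (Finₚ.↑ʳ-injective m _ _) i j)
                 (trans (cong₂ dartAdj (dart-↑ʳ i) (dart-↑ʳ j)) (dartAdj-swap² (edge i) (edge j))))

    sameBlock+crossBlock : ∀ i j → sameBlock i j + crossBlock i j ≡ (t ·1ₘ) i j - adjL G i j
    sameBlock+crossBlock i j =
      trans (regroup ((t ·1ₘ) i j) (dartAdj (edge i) (edge j)) (dartAdj (edge i) (swap (edge j))))
            (cong (_-_ ((t ·1ₘ) i j)) (dartAdj-edge-+ i j))
      where
      regroup : ∀ a h h′ → (a - h) + - h′ ≡ a - (h + h′)
      regroup = solve-∀

    sameBlock-crossBlock : ∀ i j → sameBlock i j - crossBlock i j ≡ (t ·1ₘ) i j - antiM G i j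
    sameBlock-crossBlock i j =
      trans (regroup ((t ·1ₘ) i j) (dartAdj (edge i) (edge j)) (dartAdj (edge i) (swap (edge j))))
            (cong (_-_ ((t ·1ₘ) i j)) (dartAdj-edge-- i j))
      where
      regroup : ∀ a h h′ → (a - h) - - h′ ≡ a - (h - h′)
      regroup = solve-∀

mainTheorem13 : (G : SimpleGraph) (t : ℤ) →
    charPolyAt (adjHL G) t ≡ charPolyAt (adjL G) t * charPolyAt (antiM G) t
mainTheorem13 G t = begin
  charPolyAt (adjHL G) t
    ≡⟨ det-reindex (length-darts G) (λ i j → (t ·1ₘ) i j - adjHL G i j) (dartIndex G) (dartIndex-injective G) ⟨
  det (charHL G t)
    ≡⟨ det-symmetricBlock (charHL G t) (sameBlock G t) (crossBlock G)
         (charHL-↑ˡ↑ˡ G t) (charHL-↑ˡ↑ʳ G t) (charHL-↑ʳ↑ˡ G t) (charHL-↑ʳ↑ʳ G t) ⟩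
  det (λ i j → sameBlock G t i j + crossBlock G i j) * det (λ i j → sameBlock G t i j - crossBlock G i j)
    ≡⟨ cong₂ _*_ (det-cong (sameBlock+crossBlock G t)) (det-cong (sameBlock-crossBlock G t)) ⟩
  charPolyAt (adjL G) t * charPolyAt (antiM G) t ∎
  where open ≡-Reasoning
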